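{- Let $T$ be a tree with at least two vertices and let $\mathcal{T}=\{t_1,\ldots,t_n\}$ be a multiset of subtrees of $T$. Then there exist a tree $T'$ and a set $\mathcal{T}'=\{t'_1,\ldots,t'_n\}$ of subtrees of $T'$ such that: (i) for all $1\le i,j\le n$, $(t_i,t_j)\sim(t'_i,t'_j)$; (ii) $T'$ is a subdivision of $T$; and (iii) $\mathcal{T}'$ satisfies the nontrivial intersection distinct leaf property.
   Context: Subtrees of a tree are given as sets of vertices inducing subtrees. Two sets $A,B$ overlap, written $A\between B$, if $A\cap B\neq\emptyset$, $A\not\subseteq B$ and $B\not\subseteq A$; they are disjoint, written $A\,|\,B$, if $A\cap B=\emptyset$. For nonempty sets $A,B,A',B'$, $(A,B)\sim(A',B')$ means: $A\,|\,B$ iff $A'\,|\,B'$, and $A\between B$ iff $A'\between B'$. A graph $H$ is a subdivision of a graph $G$ if $H$ can be obtained from $G$ by zero or more edge subdivisions (replacing an edge $uv$ by a new vertex $x$ and edges $ux$, $xv$). A collection $\mathcal{T}$ of subtrees of a tree $T$ satisfies the nontrivial intersection distinct leaf property if: each element of $\mathcal{T}$ has at least two vertices; every pair of elements of $\mathcal{T}$ are either disjoint or share two or more vertices; and no vertex of $T$ is a leaf of two distinct members of $\mathcal{T}$. -}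

module Defs where

open import Level using (0ℓ)
open import Data.Nat using (ℕ; zero; suc; _≤_)
open import Data.Fin using (Fin; zero; suc; inject₁; fromℕ)
open import Data.Fin.Subset using (Subset; _∈_; _∩_; _⊆_; ⊤)
open import Data.Product using (Σ; ∃; ∃-syntax; _×_; _,_)
open import Data.Sum using (_⊎_; inj₁; inj₂)
open import Data.Fin.Properties using (inject₁-injective; fromℕ≢inject₁)
open import Data.Empty using (⊥)
open import Relation.Nullary using (¬_)
open import Relation.Binary.PropositionalEquality using (_≡_; _≢_)
import Relation.Binary.PropositionalEquality as ≡
open import Function.Bundles using (_↔_; _⇔_; Inverse)
open import Function.Definitions using (Injective)

record Graph : Set₁ where
  field
    n      : ℕ
    Adj    : Fin n → Fin n → Set
    sym    : ∀ {x y} → Adj x y → Adj y x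
    irrefl : ∀ {x} → ¬ Adj x x
open Graph public

data WalkIn (G : Graph) (P : Subset (n G)) : Fin (n G) → Fin (n G) → Set where
  nil  : ∀ {x} → x ∈ P → WalkIn G P x x
  cons : ∀ {x y z} → x ∈ P → Adj G x y → WalkIn G P y z → WalkIn G P x z

record CycleIn (G : Graph) (P : Subset (n G)) : Set where
  field
    k      : ℕ
    c      : Fin (suc (suc (suc k))) → Fin (n G)
    inj    : Injective _≡_ _≡_ c
    inP    : ∀ i → c i ∈ P
    step   : ∀ (i : Fin (suc (suc k))) → Adj G (c (inject₁ i)) (c (suc i))
    close  : Adj G (c (fromℕ (suc (suc k)))) (c zero)

record IsTreeOn (G : Graph) (P : Subset (n G)) : Set where
  field
    nonempty  : ∃[ x ] x ∈ P
    connected : ∀ {x y} → x ∈ P → y ∈ P → WalkIn G P x y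
    acyclic   : ¬ CycleIn G P

IsTree : Graph → Set
IsTree G = IsTreeOn G ⊤

IsSubtree : (T : Graph) → Subset (n T) → Set
IsSubtree T S = IsTreeOn T S

record Iso (G H : Graph) : Set where
  field
    f   : Fin (n G) ↔ Fin (n H)
    adj : ∀ x y → Adj G x y ⇔ Adj H (Inverse.to f x) (Inverse.to f y)

-- Subdivide the edge uv of G: new vertex is fromℕ (n G), old vertices
-- are embedded by inject₁.
data SubAdj (G : Graph) (u v : Fin (n G)) (z w : Fin (suc (n G))) : Set where
  old     : ∀ x y → z ≡ inject₁ x → w ≡ inject₁ y → Adj G x y
          → ¬ ((x ≡ u × y ≡ v) ⊎ (x ≡ v × y ≡ u)) → SubAdj G u v z w
  toNew   : ∀ x → z ≡ inject₁ x → w ≡ fromℕ (n G) → (x ≡ u ⊎ x ≡ v) → SubAdj G u v z w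
  fromNew : ∀ x → z ≡ fromℕ (n G) → w ≡ inject₁ x → (x ≡ u ⊎ x ≡ v) → SubAdj G u v z w

private
  swap⊎ : ∀ {G : Graph} {u v x y : Fin (n G)}
        → ¬ ((x ≡ u × y ≡ v) ⊎ (x ≡ v × y ≡ u))
        → ¬ ((y ≡ u × x ≡ v) ⊎ (y ≡ v × x ≡ u))
  swap⊎ h (inj₁ (a , b)) = h (inj₂ (b , a))
  swap⊎ h (inj₂ (a , b)) = h (inj₁ (b , a))

  subSym : ∀ {G u v z w} → SubAdj G u v z w → SubAdj G u v w z
  subSym {G} (old x y p q a h) = old y x q p (sym G a) (swap⊎ {G} h)
  subSym (toNew x p q h) = fromNew x q p h
  subSym (fromNew x p q h) = toNew x q p h

  subIrr : ∀ {G u v z} → ¬ SubAdj G u v z z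
  subIrr {G} (old x y p q a _) rewrite inject₁-injective (≡.trans (≡.sym p) q) = irrefl G a
  subIrr (toNew x p q _) = fromℕ≢inject₁ (≡.trans (≡.sym q) p)
  subIrr (fromNew x p q _) = fromℕ≢inject₁ (≡.trans (≡.sym p) q)

subdivide : (G : Graph) → Fin (n G) → Fin (n G) → Graph
subdivide G u v = record
  { n = suc (n G) ; Adj = SubAdj G u v ; sym = subSym ; irrefl = subIrr }

data Iterated (G : Graph) : Graph → Set₁ where
  here : Iterated G G
  step : ∀ {H} → Iterated G H → ∀ u v → Adj H u v → Iterated G (subdivide H u v)

IsSubdivisionOf : Graph → Graph → Set₁
IsSubdivisionOf H G = Σ Graph λ K → Iterated G K × Iso K H

Disjoint : ∀ {m} → Subset m → Subset m → Set
Disjoint A B = ¬ (∃[ x ] x ∈ (A ∩ B))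

Overlap : ∀ {m} → Subset m → Subset m → Set
Overlap A B = (∃[ x ] x ∈ (A ∩ B)) × ¬ (A ⊆ B) × ¬ (B ⊆ A)

Similar : ∀ {m m'} → Subset m → Subset m → Subset m' → Subset m' → Set
Similar A B A' B' = (Disjoint A B ⇔ Disjoint A' B') × (Overlap A B ⇔ Overlap A' B')

HasTwoVertices : ∀ {m} → Subset m → Set
HasTwoVertices A = ∃[ x ] ∃[ y ] x ≢ y × x ∈ A × y ∈ A

IsLeafOf : (T : Graph) → Fin (n T) → Subset (n T) → Set
IsLeafOf T v S = v ∈ S × (∃[ w ] (w ∈ S × Adj T v w × (∀ w' → w' ∈ S → Adj T v w' → w' ≡ w)))

NIDLP : (T : Graph) {k : ℕ} → (Fin k → Subset (n T)) → Set
NIDLP T {k} t =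
  (∀ i → HasTwoVertices (t i)) ×
  (∀ i j → Disjoint (t i) (t j) ⊎ HasTwoVertices (t i ∩ t j)) ×
  (∀ i j → i ≢ j → ∀ v → ¬ (IsLeafOf T v (t i) × IsLeafOf T v (t j)))

module Submission where

-- Subdivide every edge of T by the same large number M of new
-- vertices.  On each edge uv, t'ᵢ occupies an interval [lo , hi] of the
-- positions 0 (= u), 1, …, M + 1 (= v), chosen according to which ends of
-- the edge lie in tᵢ and whether they are leaves of T; in addition t'ᵢ
-- contains the inner vertices of T that lie in tᵢ.  The interval ends
-- strictly inside an edge lie in four disjoint bands of positions and
-- encode i through a key κ i = i + ∣tᵢ∣·k that increases with inclusion.
-- Hence t'ᵢ and t'ⱼ share two vertices iff tᵢ and tⱼ meet, containments
-- become nestings and non-containments persist (so ∼ is preserved), and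
-- every leaf of t'ᵢ is a position encoding i, so leaves are never shared.

open import Defs
open import Data.Nat using (ℕ; _≤_)
open import Data.Fin using (Fin)
open import Data.Fin.Subset using (Subset)
open import Data.Product using (Σ; _×_)

open import Data.Bool using (true; if_then_else_)
open import Data.Empty using (⊥; ⊥-elim; ⊥-elim-irr)
open import Data.Fin using (zero; suc; toℕ; inject₁; fromℕ)
open import Data.Fin.Properties using (inject₁-injective; fromℕ≢inject₁; _≟_)
import Data.Fin.Properties as Finₚ
open import Data.Fin.Relation.Unary.Top using (View; view; ‵fromℕ; ‵inject₁; view-fromℕ; view-inject₁)
open import Data.Fin.Subset using (_∈_; _∉_; _⊆_; _∩_; ⊤; ∣_∣)
open import Data.Fin.Subset.Properties using (∈⊤; _∈?_; _⊆?_; x∈p∩q⁺; x∈p∩q⁻; p⊂q⇒∣p∣<∣q∣; ∣p∣≤n)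
open import Data.List using (List; []; _∷_; _++_; foldl; allFin; cartesianProduct)
open import Data.List.Properties using (++-assoc; ∷-injectiveʳ)
open import Data.List.Relation.Unary.Any using (here; there; any?)
open import Data.List.Membership.Propositional using () renaming (_∈_ to _∈ₗ_)
open import Data.List.Membership.Propositional.Properties using (∈-++⁻; ∈-∃++; ∈-allFin; ∈-cartesianProduct⁺)
open import Data.Nat using (zero; suc; _+_; _*_; _∸_; _%_; _<_; z≤n; s≤s; s≤s⁻¹; pred; _≤?_; _<?_)
import Data.Nat.Properties as ℕₚ
open import Data.Nat.DivMod using (m<n⇒m%n≡m; [m+kn]%n≡m%n)
open import Data.Product using (∃; ∃-syntax; _,_; proj₁; proj₂)
open import Data.Sum using (_⊎_; inj₁; inj₂)
open import Data.Unit using (tt) renaming (⊤ to Unit)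
import Data.Vec.Base as Vec
import Data.Vec.Properties as Vecₚ
open import Function.Base using (_∘_)
open import Function.Bundles using (mk⇔)
open import Function.Construct.Identity using (↔-id; ⇔-id)
open import Function.Definitions using (Injective)
open import Relation.Binary.Definitions using (tri<; tri≈; tri>)
open import Relation.Binary.PropositionalEquality using (_≡_; _≢_; refl; trans; cong; subst; subst₂)
import Relation.Binary.PropositionalEquality as ≡
open import Relation.Nullary using (¬_; Dec; yes; no; does; ¬?)
open import Relation.Nullary.Decidable using (_×-dec_; _⊎-dec_; _→-dec_; dec-true; dec-false)

module _ {G : Graph} {P : Subset (n G)} where

  walkStart : ∀ {x y} → WalkIn G P x y → x ∈ P
  walkStart (nil p) = p
  walkStart (cons p _ _) = p

  _++ʷ_ : ∀ {x y z} → WalkIn G P x y → WalkIn G P y z → WalkIn G P x z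
  nil _ ++ʷ w' = w'
  cons p e w ++ʷ w' = cons p e (w ++ʷ w')

  reverseʷ : ∀ {x y} → WalkIn G P x y → WalkIn G P y x
  reverseʷ (nil p) = nil p
  reverseʷ (cons p e w) = reverseʷ w ++ʷ cons (walkStart w) (sym G e) (nil p)

tree-acyclic-in : ∀ {G : Graph} {P : Subset (n G)} → IsTree G → ¬ CycleIn G P
tree-acyclic-in TG C = IsTreeOn.acyclic TG (record
  { k = CycleIn.k C ; c = CycleIn.c C ; inj = CycleIn.inj C ; inP = λ _ → ∈⊤
  ; step = CycleIn.step C ; close = CycleIn.close C })

data Path (G : Graph) : Fin (n G) → Fin (n G) → ℕ → Set where
  stop : ∀ {x} → Path G x x 0
  hop  : ∀ {x y z l} → Adj G x y → Path G y z l → Path G x z (suc l)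

_∈ₗ?_ : ∀ {m} (x : Fin m) (xs : List (Fin m)) → Dec (x ∈ₗ xs)
x ∈ₗ? xs = any? (x ≟_) xs

module _ {G : Graph} where

  vertices : ∀ {x y l} → Path G x y l → List (Fin (n G))
  vertices {x} stop = x ∷ []
  vertices {x} (hop e p) = x ∷ vertices p

  IsSimple : ∀ {x y l} → Path G x y l → Set
  IsSimple stop = Unit
  IsSimple {x} (hop e p) = (¬ (x ∈ₗ vertices p)) × IsSimple p

  start∈ : ∀ {x y l} (p : Path G x y l) → x ∈ₗ vertices p
  start∈ stop = here refl
  start∈ (hop e p) = here refl

  end∈ : ∀ {x y l} (p : Path G x y l) → y ∈ₗ vertices p
  end∈ stop = here refl
  end∈ (hop e p) = there (end∈ p)

  vertexAt : ∀ {x y l} → Path G x y l → Fin (suc l) → Fin (n G)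
  vertexAt {x} p zero = x
  vertexAt (hop e p) (suc i) = vertexAt p i

  vertexAt-∈ : ∀ {x y l} (p : Path G x y l) i → vertexAt p i ∈ₗ vertices p
  vertexAt-∈ stop zero = here refl
  vertexAt-∈ (hop e p) zero = here refl
  vertexAt-∈ (hop e p) (suc i) = there (vertexAt-∈ p i)

  vertexAt-last : ∀ {x y l} (p : Path G x y l) → vertexAt p (fromℕ l) ≡ y
  vertexAt-last stop = refl
  vertexAt-last (hop e p) = vertexAt-last p

  vertexAt-step : ∀ {x y l} (p : Path G x y l) (i : Fin l) → Adj G (vertexAt p (inject₁ i)) (vertexAt p (suc i))
  vertexAt-step (hop e p) zero = e
  vertexAt-step (hop e p) (suc i) = vertexAt-step p i

  vertexAt-injective : ∀ {x y l} (p : Path G x y l) → IsSimple p → ∀ i j → vertexAt p i ≡ vertexAt p j → i ≡ j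
  vertexAt-injective stop s zero zero eq = refl
  vertexAt-injective (hop e p) s zero zero eq = refl
  vertexAt-injective (hop e p) (fr , s) zero (suc j) eq = ⊥-elim (fr (subst (_∈ₗ vertices p) (≡.sym eq) (vertexAt-∈ p j)))
  vertexAt-injective (hop e p) (fr , s) (suc i) zero eq = ⊥-elim (fr (subst (_∈ₗ vertices p) eq (vertexAt-∈ p i)))
  vertexAt-injective (hop e p) (fr , s) (suc i) (suc j) eq = cong suc (vertexAt-injective p s i j eq)

  closeCycle : ∀ {x y k} (p : Path G x y (suc (suc k))) → IsSimple p → Adj G y x → CycleIn G ⊤
  closeCycle {x} {y} {k} p s e = record
    { k = k ; c = vertexAt p ; inj = λ {i} {j} → vertexAt-injective p s i j ; inP = λ _ → ∈⊤
    ; step = vertexAt-step p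
    ; close = subst (λ w → Adj G w x) (≡.sym (vertexAt-last p)) e }

  dropUntil : ∀ {x y z l} (q : Path G y z l) → IsSimple q → x ∈ₗ vertices q → Σ ℕ λ l' → Σ (Path G x z l') IsSimple
  dropUntil stop s (here refl) = _ , stop , tt
  dropUntil (hop e q) s (here refl) = _ , hop e q , s
  dropUntil (hop e q) (_ , s) (there m) = dropUntil q s m

  shortcut : ∀ {P x y} → WalkIn G P x y → Σ ℕ λ l → Σ (Path G x y l) IsSimple
  shortcut (nil _) = 0 , stop , tt
  shortcut {x = x} (cons _ e w) with shortcut w
  ... | l , q , s with x ∈ₗ? vertices q
  ...   | yes m = dropUntil q s m
  ...   | no nm = suc l , hop e q , nm , s

  pathThrough : ∀ {l} (f : Fin (suc l) → Fin (n G)) → (∀ (i : Fin l) → Adj G (f (inject₁ i)) (f (suc i)))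
              → Path G (f zero) (f (fromℕ l)) l
  pathThrough {zero} f s = stop
  pathThrough {suc l} f s = hop (s zero) (pathThrough (λ i → f (suc i)) (λ i → s (suc i)))

  pathThrough-vertices : ∀ {l} (f : Fin (suc l) → Fin (n G)) s w → w ∈ₗ vertices (pathThrough f s) → ∃[ i ] w ≡ f i
  pathThrough-vertices {zero} f s w (here eq) = zero , eq
  pathThrough-vertices {suc l} f s w (here eq) = zero , eq
  pathThrough-vertices {suc l} f s w (there m) with pathThrough-vertices (λ i → f (suc i)) (λ i → s (suc i)) w m
  ... | i , eq = suc i , eq

  pathThrough-simple : ∀ {l} (f : Fin (suc l) → Fin (n G)) s → Injective _≡_ _≡_ f → IsSimple (pathThrough f s)
  pathThrough-simple {zero} f s inj = tt
  pathThrough-simple {suc l} f s inj =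
    (λ m → head-fresh (pathThrough-vertices (λ i → f (suc i)) (λ i → s (suc i)) (f zero) m))
    , pathThrough-simple (λ i → f (suc i)) (λ i → s (suc i)) (λ eq → Finₚ.suc-injective (inj eq))
    where
    head-fresh : (∃[ i ] f zero ≡ f (suc i)) → ⊥
    head-fresh (i , eq) with inj eq
    ... | ()

  -- Cycles presented as a simple path with at least three vertices whose
  -- last vertex is adjacent to its first; unlike CycleIn this form can be
  -- rotated and analysed edge by edge.
  record ClosedPath : Set where
    field
      {a b} : Fin (n G)
      {k}   : ℕ
      path  : Path G a b (suc (suc k))
      simple : IsSimple path
      close : Adj G b a

  cycle⇒closedPath : ∀ {P} → CycleIn G P → ClosedPath
  cycle⇒closedPath C = record
    { path = pathThrough (CycleIn.c C) (CycleIn.step C)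
    ; simple = pathThrough-simple (CycleIn.c C) (CycleIn.step C) (CycleIn.inj C)
    ; close = CycleIn.close C }

  snoc : ∀ {x y w l} → Path G x y l → Adj G y w → Path G x w (suc l)
  snoc stop e = hop e stop
  snoc (hop e' p) e = hop e' (snoc p e)

  vertices-snoc : ∀ {x y w l} (p : Path G x y l) (e : Adj G y w) → vertices (snoc p e) ≡ vertices p ++ (w ∷ [])
  vertices-snoc stop e = refl
  vertices-snoc (hop e' p) e = cong (_ ∷_) (vertices-snoc p e)

  snoc-simple : ∀ {x y w l} (p : Path G x y l) (e : Adj G y w) → IsSimple p → ¬ (w ∈ₗ vertices p) → IsSimple (snoc p e)
  snoc-simple {x} {w = w} stop e s w∉ = (λ { (here eq) → w∉ (here (≡.sym eq)) ; (there ()) }) , tt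
  snoc-simple {x} {w = w} (hop e' p) e (x∉ , s) w∉ =
    (λ m → x∉snoc (∈-++⁻ (vertices p) (subst (x ∈ₗ_) (vertices-snoc p e) m)))
    , snoc-simple p e s (λ m → w∉ (there m))
    where
    x∉snoc : x ∈ₗ vertices p ⊎ x ∈ₗ (w ∷ []) → ⊥
    x∉snoc (inj₁ m) = x∉ m
    x∉snoc (inj₂ (here eq)) = w∉ (here (≡.sym eq))

  rotateTo : ∀ {z} (C : ClosedPath) pre post → vertices (ClosedPath.path C) ≡ pre ++ z ∷ post
           → Σ ClosedPath λ C' → ClosedPath.a C' ≡ z
  rotateTo C@record { a = a ; path = hop e q } [] post eq = C , cong (headOr a) eq
    where
    headOr : Fin (n G) → List (Fin (n G)) → Fin (n G)
    headOr d [] = d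
    headOr d (h ∷ _) = h
  rotateTo {z} record { a = a ; path = hop e q ; simple = (a∉ , s) ; close = cls } (w ∷ pre) post eq =
    rotateTo (record { path = snoc q cls ; simple = snoc-simple q cls s a∉ ; close = e }) pre (post ++ (a ∷ []))
      (trans (vertices-snoc q cls)
        (trans (cong (_++ (a ∷ [])) (∷-injectiveʳ eq)) (++-assoc pre (z ∷ post) (a ∷ []))))

-- In a tree, adjacency is decidable: x and y are adjacent exactly when the
-- simple path between them has length one (a longer one would close a cycle).
tree-adj? : ∀ (G : Graph) → IsTree G → ∀ x y → Dec (Adj G x y)
tree-adj? G T x y with x ≟ y
... | yes refl = no (irrefl G)
... | no x≢y with shortcut (IsTreeOn.connected T {x} {y} ∈⊤ ∈⊤)
... | zero , stop , _ = ⊥-elim (x≢y refl)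
... | suc zero , hop e stop , _ = yes e
... | suc (suc k) , p , s = no λ a → IsTreeOn.acyclic T (closeCycle p s (sym G a))

module SubdivideEdge (G : Graph) (u v : Fin (n G)) (uv : Adj G u v) where

  G' : Graph
  G' = subdivide G u v

  z : Fin (suc (n G))
  z = fromℕ (n G)

  z-neighbours : ∀ {x} → SubAdj G u v z x → (x ≡ inject₁ u) ⊎ (x ≡ inject₁ v)
  z-neighbours (old x y p q a h) = ⊥-elim (fromℕ≢inject₁ p)
  z-neighbours (toNew x p q h) = ⊥-elim (fromℕ≢inject₁ p)
  z-neighbours (fromNew x p q (inj₁ refl)) = inj₁ q
  z-neighbours (fromNew x p q (inj₂ refl)) = inj₂ q

  old-adj : ∀ {a b} → SubAdj G u v (inject₁ a) (inject₁ b)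
          → Adj G a b × ¬ ((a ≡ u × b ≡ v) ⊎ (a ≡ v × b ≡ u))
  old-adj (old x y p q ad h) with inject₁-injective p | inject₁-injective q
  ... | refl | refl = ad , h
  old-adj (toNew x p q h) = ⊥-elim (fromℕ≢inject₁ (≡.sym q))
  old-adj (fromNew x p q h) = ⊥-elim (fromℕ≢inject₁ (≡.sym p))

  is-uv? : ∀ x y → Dec ((x ≡ u × y ≡ v) ⊎ (x ≡ v × y ≡ u))
  is-uv? x y = ((x ≟ u) ×-dec (y ≟ v)) ⊎-dec ((x ≟ v) ×-dec (y ≟ u))

  lift-edge : ∀ {x y} → Adj G x y → WalkIn G' ⊤ (inject₁ x) (inject₁ y)
  lift-edge {x} {y} e with is-uv? x y
  ... | yes (inj₁ (p , q)) = cons ∈⊤ (toNew x refl refl (inj₁ p)) (cons ∈⊤ (fromNew y refl refl (inj₂ q)) (nil ∈⊤))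
  ... | yes (inj₂ (p , q)) = cons ∈⊤ (toNew x refl refl (inj₂ p)) (cons ∈⊤ (fromNew y refl refl (inj₁ q)) (nil ∈⊤))
  ... | no h = cons ∈⊤ (old x y refl refl e h) (nil ∈⊤)

  lift-walk : ∀ {P x y} → WalkIn G P x y → WalkIn G' ⊤ (inject₁ x) (inject₁ y)
  lift-walk (nil _) = nil ∈⊤
  lift-walk (cons _ e w) = lift-edge e ++ʷ lift-walk w

  module _ (T : IsTree G) where

    connected : ∀ a b → WalkIn G' ⊤ a b
    connected a b with view a | view b
    ... | ‵fromℕ | ‵fromℕ = nil ∈⊤
    ... | ‵fromℕ | ‵inject₁ y =
      cons ∈⊤ (fromNew u refl refl (inj₁ refl)) (lift-walk (IsTreeOn.connected T {u} {y} ∈⊤ ∈⊤))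
    ... | ‵inject₁ x | ‵fromℕ =
      reverseʷ (cons ∈⊤ (fromNew u refl refl (inj₁ refl)) (lift-walk (IsTreeOn.connected T {u} {x} ∈⊤ ∈⊤)))
    ... | ‵inject₁ x | ‵inject₁ y = lift-walk (IsTreeOn.connected T {x} {y} ∈⊤ ∈⊤)

    lower-path : ∀ {a b l} (p : Path G' a b l) → ¬ (z ∈ₗ vertices p) → ∀ {a' b'} → a ≡ inject₁ a' → b ≡ inject₁ b'
               → Σ (Path G a' b' l) λ q → (∀ w → w ∈ₗ vertices q → inject₁ w ∈ₗ vertices p) × (IsSimple p → IsSimple q)
    lower-path stop z∉ {a'} refl eqb with inject₁-injective eqb
    ... | refl = stop , (λ { w (here refl) → here refl }) , (λ _ → tt)
    lower-path (hop {y = y} e q) z∉ {a'} refl eqb with view y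
    ... | ‵fromℕ = ⊥-elim (z∉ (there (start∈ q)))
    ... | ‵inject₁ y' with lower-path q (λ m → z∉ (there m)) refl eqb
    ... | q' , mem , simp = hop (proj₁ (old-adj e)) q'
                          , (λ { w (here refl) → here refl ; w (there m) → there (mem w m) })
                          , λ { (fr , s) → (λ m → fr (mem a' m)) , simp s }

    avoiding-z : (C : ClosedPath {G'}) → ¬ (z ∈ₗ vertices (ClosedPath.path C)) → ⊥
    avoiding-z record { a = a ; b = b ; path = p ; simple = s ; close = cls } z∉ with view a | view b
    ... | ‵fromℕ | _ = z∉ (start∈ p)
    ... | ‵inject₁ _ | ‵fromℕ = z∉ (end∈ p)
    ... | ‵inject₁ a' | ‵inject₁ b' with lower-path p z∉ refl refl
    ... | q , _ , simp = IsTreeOn.acyclic T (closeCycle q (simp s) (proj₁ (old-adj cls)))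

    single-edge : ∀ {x y} → (q : Path G' x y 1) → SubAdj G u v x y
    single-edge (hop e stop) = e

    -- A path from u to v (or v to u) in G' avoiding z, together with the edge
    -- uv of G, would close a cycle of G — unless it is the removed edge itself.
    no-uv-detour : ∀ {x y l} → ((x ≡ inject₁ u × y ≡ inject₁ v) ⊎ (x ≡ inject₁ v × y ≡ inject₁ u))
                 → (q : Path G' x y (suc l)) → IsSimple q → ¬ (z ∈ₗ vertices q) → ⊥
    no-uv-detour (inj₁ (refl , refl)) q s z∉ with lower-path q z∉ refl refl
    ... | hop _ stop , _ , _ = proj₂ (old-adj (single-edge q)) (inj₁ (refl , refl))
    ... | q'@(hop _ (hop _ _)) , _ , simp = IsTreeOn.acyclic T (closeCycle q' (simp s) (sym G uv))
    no-uv-detour (inj₂ (refl , refl)) q s z∉ with lower-path q z∉ refl refl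
    ... | hop _ stop , _ , _ = proj₂ (old-adj (single-edge q)) (inj₂ (refl , refl))
    ... | q'@(hop _ (hop _ _)) , _ , simp = IsTreeOn.acyclic T (closeCycle q' (simp s) uv)

    -- A closed path starting at z leaves z towards u or v and returns from
    -- the other one, so the rest of it is a detour between u and v.
    through-z : (C : ClosedPath {G'}) → ClosedPath.a C ≡ z → ⊥
    through-z record { b = b ; path = hop {y = x₁} e q ; simple = (z∉ , s) ; close = cls } refl
      = ends (z-neighbours e) (z-neighbours (sym G' cls)) (distinct-ends q s)
      where
      distinct-ends : ∀ {x y l} (q : Path G' x y (suc l)) → IsSimple q → x ≢ y
      distinct-ends (hop e' q') (f , _) refl = f (end∈ q')
      ends : (x₁ ≡ inject₁ u) ⊎ (x₁ ≡ inject₁ v) → (b ≡ inject₁ u) ⊎ (b ≡ inject₁ v) → x₁ ≢ b → ⊥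
      ends (inj₁ p) (inj₁ p') d = d (trans p (≡.sym p'))
      ends (inj₂ p) (inj₂ p') d = d (trans p (≡.sym p'))
      ends (inj₁ p) (inj₂ p') d = no-uv-detour (inj₁ (p , p')) q s z∉
      ends (inj₂ p) (inj₁ p') d = no-uv-detour (inj₂ (p , p')) q s z∉

    acyclic : ¬ CycleIn G' ⊤
    acyclic Cy with cycle⇒closedPath {G'} Cy
    ... | C with z ∈ₗ? vertices (ClosedPath.path C)
    ... | no z∉ = avoiding-z C z∉
    ... | yes z∈ with ∈-∃++ z∈
    ... | pre , post , eq with rotateTo C pre post eq
    ... | C' , starts-z = through-z C' starts-z

    subdivide-tree : IsTree G'
    subdivide-tree = record
      { nonempty = inject₁ u , ∈⊤
      ; connected = λ {a} {b} _ _ → connected a b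
      ; acyclic = acyclic }

has-neighbour : (T : Graph) → IsTree T → 2 ≤ n T → ∀ x → ∃[ y ] Adj T x y
has-neighbour T TT two x = first-step (IsTreeOn.connected TT {x} {other (n T) two x} ∈⊤ ∈⊤) (other-≢ (n T) two x)
  where
  other : ∀ m → 2 ≤ m → Fin m → Fin m
  other (suc zero) (s≤s ()) _
  other (suc (suc m)) _ zero = suc zero
  other (suc (suc m)) _ (suc x) = zero
  other-≢ : ∀ m (two : 2 ≤ m) (x : Fin m) → other m two x ≢ x
  other-≢ (suc zero) (s≤s ()) _
  other-≢ (suc (suc m)) _ zero ()
  other-≢ (suc (suc m)) _ (suc x) ()
  first-step : ∀ {x y} → WalkIn T ⊤ x y → y ≢ x → ∃[ w ] Adj T x w
  first-step (nil _) y≢x = ⊥-elim (y≢x refl)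
  first-step (cons _ e _) _ = _ , e

Inner : (T : Graph) → Fin (n T) → Set
Inner T x = ∃[ y₁ ] ∃[ y₂ ] (y₁ ≢ y₂ × Adj T x y₁ × Adj T x y₂)

inner? : (T : Graph) → IsTree T → ∀ x → Dec (Inner T x)
inner? T TT x = Finₚ.any? λ y₁ → Finₚ.any? λ y₂ →
  (¬? (y₁ ≟ y₂)) ×-dec (tree-adj? T TT x y₁ ×-dec tree-adj? T TT x y₂)

leaf-neighbour-unique : ∀ (T : Graph) {x y y'} → ¬ Inner T x → Adj T x y → Adj T x y' → y ≡ y'
leaf-neighbour-unique T {y = y} {y'} leaf e e' with y ≟ y'
... | yes eq = eq
... | no ne = ⊥-elim (leaf (y , y' , ne , e , e'))

⊈⇒∃∉ : ∀ {m} (p q : Subset m) → ¬ (p ⊆ q) → ∃[ x ] (x ∈ p × x ∉ q)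
⊈⇒∃∉ {m} p q p⊈q with Finₚ.¬∀⟶∃¬ m (λ x → x ∈ p → x ∈ q) (λ x → (x ∈? p) →-dec (x ∈? q)) (λ h → p⊈q (λ {x} → h x))
... | x , x∉ with x ∈? p | x ∈? q
...   | _ | yes x∈q = ⊥-elim (x∉ (λ _ → x∈q))
...   | no x∉p | no _ = ⊥-elim (x∉ (λ x∈p → ⊥-elim (x∉p x∈p)))
...   | yes x∈p | no x∉q = x , x∈p , x∉q

subsetOf : ∀ {m} {P : Fin m → Set} → (∀ x → Dec (P x)) → Subset m
subsetOf P? = Vec.tabulate (λ x → does (P? x))

module _ {m} {P : Fin m → Set} (P? : ∀ x → Dec (P x)) where

  ∈subsetOf⁻ : ∀ {x} → x ∈ subsetOf P? → P x
  ∈subsetOf⁻ {x} x∈ = witness (P? x) (trans (≡.sym (Vecₚ.lookup∘tabulate _ x)) (Vecₚ.[]=⇒lookup x∈))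
    where
    witness : (d : Dec (P x)) → does d ≡ true → P x
    witness (yes p) _ = p

  ∈subsetOf⁺ : ∀ {x} → P x → x ∈ subsetOf P?
  ∈subsetOf⁺ {x} px = Vecₚ.lookup⇒[]= x (subsetOf P?) (trans (Vecₚ.lookup∘tabulate _ x) (holds (P? x)))
    where
    holds : (d : Dec (P x)) → does d ≡ true
    holds (yes _) = refl
    holds (no ¬px) = ⊥-elim (¬px px)

Meet : ∀ {m} → Subset m → Subset m → Set
Meet A B = ∃[ x ] x ∈ (A ∩ B)

similar-by : ∀ {m m'} {A B : Subset m} {A' B' : Subset m'}
           → (Meet A B → Meet A' B') → (Meet A' B' → Meet A B)
           → (¬ (A ⊆ B) → ¬ (A' ⊆ B')) → (¬ (B ⊆ A) → ¬ (B' ⊆ A'))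
           → (A ⊆ B → (A' ⊆ B') ⊎ (B' ⊆ A')) → (B ⊆ A → (B' ⊆ A') ⊎ (A' ⊆ B'))
           → Similar A B A' B'
similar-by meet⇒ meet⇐ ⊈AB ⊈BA nestAB nestBA =
  mk⇔ (λ d m' → d (meet⇐ m')) (λ d' m → d' (meet⇒ m)) ,
  mk⇔ (λ { (m , A⊈B , B⊈A) → meet⇒ m , ⊈AB A⊈B , ⊈BA B⊈A })
      (λ { (m' , A'⊈B' , B'⊈A') → meet⇐ m' , not-nested A'⊈B' B'⊈A' ∘ nestAB , not-nested B'⊈A' A'⊈B' ∘ nestBA })
  where
  not-nested : ∀ {P Q : Set} → ¬ P → ¬ Q → ¬ (P ⊎ Q)
  not-nested ¬p ¬q (inj₁ p) = ¬p p
  not-nested ¬p ¬q (inj₂ q) = ¬q q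

remainder-unique : ∀ k r s a b → r < k → s < k → r + a * k ≡ s + b * k → r ≡ s
remainder-unique (suc k) r s a b r<k s<k eq = begin
  r                       ≡⟨ ≡.sym (m<n⇒m%n≡m r<k) ⟩
  r % suc k               ≡⟨ ≡.sym ([m+kn]%n≡m%n r a (suc k)) ⟩
  (r + a * suc k) % suc k ≡⟨ cong (_% suc k) eq ⟩
  (s + b * suc k) % suc k ≡⟨ [m+kn]%n≡m%n s b (suc k) ⟩
  s % suc k               ≡⟨ m<n⇒m%n≡m s<k ⟩
  s                       ∎
  where open ≡.≡-Reasoning

module Keys {m k : ℕ} (t : Fin k → Subset m) where

  K : ℕ
  K = suc m * k

  κ : Fin k → ℕ
  κ i = toℕ i + ∣ t i ∣ * k

  κ<K : ∀ i → κ i < K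
  κ<K i = ℕₚ.+-mono-<-≤ (Finₚ.toℕ<n i) (ℕₚ.*-monoˡ-≤ k (∣p∣≤n (t i)))

  κ-injective : ∀ i j → κ i ≡ κ j → i ≡ j
  κ-injective i j eq = Finₚ.toℕ-injective (remainder-unique k (toℕ i) (toℕ j) ∣ t i ∣ ∣ t j ∣ (Finₚ.toℕ<n i) (Finₚ.toℕ<n j) eq)

  κ-strict : ∀ i j → t i ⊆ t j → ¬ (t j ⊆ t i) → κ i < κ j
  κ-strict i j ti⊆tj tj⊈ti with ⊈⇒∃∉ (t j) (t i) tj⊈ti
  ... | x , x∈tj , x∉ti =
    ℕₚ.<-≤-trans (ℕₚ.+-monoˡ-< (∣ t i ∣ * k) (Finₚ.toℕ<n i))
      (ℕₚ.≤-trans (ℕₚ.*-monoˡ-≤ k (p⊂q⇒∣p∣<∣q∣ (ti⊆tj , x , x∈tj , x∉ti))) (ℕₚ.m≤n+m (∣ t j ∣ * k) (toℕ j)))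

  ρ : Fin k → ℕ
  ρ i = K ∸ κ i

  ρ≥1 : ∀ i → 1 ≤ ρ i
  ρ≥1 i = ℕₚ.m<n⇒0<n∸m (κ<K i)

  ρ≤K : ∀ i → ρ i ≤ K
  ρ≤K i = ℕₚ.m∸n≤m K (κ i)

  ρ-antitone : ∀ i j → κ i ≤ κ j → ρ j ≤ ρ i
  ρ-antitone i j le = ℕₚ.∸-monoʳ-≤ K le

  ρ-injective : ∀ i j → ρ i ≡ ρ j → i ≡ j
  ρ-injective i j eq = κ-injective i j (ℕₚ.∸-cancelˡ-≡ (ℕₚ.<⇒≤ (κ<K i)) (ℕₚ.<⇒≤ (κ<K j)) eq)

iso-refl : ∀ G → Iso G G
iso-refl G = record { f = ↔-id (Fin (n G)) ; adj = λ x y → ⇔-id (Adj G x y) }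

-- Each vertex of the
-- subdivided graph is labelled either by an original vertex x of T, or by
-- mid u v p: the p-th new vertex (counting from 0) on the edge uv of T,
-- where edges are oriented from the smaller to the larger index.
module Coordinates (T : Graph) where

  data Label : Set where
    orig : Fin (n T) → Label
    mid  : Fin (n T) → Fin (n T) → ℕ → Label

  orig-injective : ∀ {x y} → orig x ≡ orig y → x ≡ y
  orig-injective refl = refl

  mid-injective : ∀ {a b p a' b' p'} → mid a b p ≡ mid a' b' p' → a ≡ a' × b ≡ b' × p ≡ p'
  mid-injective refl = refl , refl , refl

  orig≢mid : ∀ {x a b p} → orig x ≢ mid a b p
  orig≢mid ()

  _≟ₗ_ : ∀ (l l' : Label) → Dec (l ≡ l')
  orig x ≟ₗ orig y with x ≟ y
  ... | yes refl = yes refl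
  ... | no x≢y = no λ { refl → x≢y refl }
  orig x ≟ₗ mid _ _ _ = no λ ()
  mid _ _ _ ≟ₗ orig _ = no λ ()
  mid a b p ≟ₗ mid a' b' p' with a ≟ a' | b ≟ b' | p ℕₚ.≟ p'
  ... | yes refl | yes refl | yes refl = yes refl
  ... | no ne | _ | _ = no λ { refl → ne refl }
  ... | yes _ | no ne | _ = no λ { refl → ne refl }
  ... | yes _ | yes _ | no ne = no λ { refl → ne refl }

  -- len x y : the number of new vertices on the edge from x to y.
  Lengths : Set
  Lengths = Fin (n T) → Fin (n T) → ℕ

  LAdj : Lengths → Label → Label → Set
  LAdj len (orig x) (orig y) = Adj T x y × len x y ≡ 0 × len y x ≡ 0
  LAdj len (orig x) (mid a b p) = (x ≡ a × p ≡ 0) ⊎ (x ≡ b × suc p ≡ len a b)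
  LAdj len (mid a b p) (orig x) = (x ≡ a × p ≡ 0) ⊎ (x ≡ b × suc p ≡ len a b)
  LAdj len (mid a b p) (mid a' b' p') = a ≡ a' × b ≡ b' × (suc p ≡ p' ⊎ suc p' ≡ p)

  LAdj-sym : ∀ {len} l₁ l₂ → LAdj len l₁ l₂ → LAdj len l₂ l₁
  LAdj-sym (orig x) (orig y) (a , p , q) = sym T a , q , p
  LAdj-sym (orig x) (mid a b p) h = h
  LAdj-sym (mid a b p) (orig x) h = h
  LAdj-sym (mid a b p) (mid a' b' p') (refl , refl , inj₁ q) = refl , refl , inj₂ q
  LAdj-sym (mid a b p) (mid a' b' p') (refl , refl , inj₂ q) = refl , refl , inj₁ q

  Valid : Lengths → Label → Set
  Valid len (orig x) = Unit
  Valid len (mid a b p) = p < len a b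

  record Subdivided : Set₁ where
    field
      G      : Graph
      iter   : Iterated T G
      tree   : IsTree G
      len    : Lengths
      oriented : ∀ x y → toℕ y ≤ toℕ x → len x y ≡ 0
      on-edge  : ∀ x y → 0 < len x y → Adj T x y
      label  : Fin (n G) → Label
      valid  : ∀ a → Valid len (label a)
      vertex : (l : Label) → .(Valid len l) → Fin (n G)
      label-vertex : ∀ l .(w : Valid len l) → label (vertex l w) ≡ l
      vertex-label : ∀ a → vertex (label a) (valid a) ≡ a
      adj    : ∀ a b → (Adj G a b → LAdj len (label a) (label b)) × (LAdj len (label a) (label b) → Adj G a b)

    vertex-unique : ∀ a l → label a ≡ l → .(w : Valid len l) → vertex l w ≡ a
    vertex-unique a .(label a) refl w = vertex-label a

  unsubdivided : IsTree T → Subdivided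
  unsubdivided TT = record
    { G = T ; iter = here ; tree = TT ; len = λ _ _ → 0
    ; oriented = λ _ _ _ → refl ; on-edge = λ _ _ ()
    ; label = orig ; valid = λ _ → tt
    ; vertex = vertex₀ ; label-vertex = label-vertex₀ ; vertex-label = λ _ → refl
    ; adj = λ a b → (λ e → e , refl , refl) , proj₁ }
    where
    vertex₀ : (l : Label) → .(Valid (λ _ _ → 0) l) → Fin (n T)
    vertex₀ (orig x) _ = x
    vertex₀ (mid _ _ _) w = ⊥-elim-irr (ℕₚ.n≮0 w)
    label-vertex₀ : ∀ l .(w : Valid (λ _ _ → 0) l) → orig (vertex₀ l w) ≡ l
    label-vertex₀ (orig x) _ = refl
    label-vertex₀ (mid _ _ _) w = ⊥-elim-irr (ℕₚ.n≮0 w)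

  is-uv? : ∀ (u v x y : Fin (n T)) → Dec (x ≡ u × y ≡ v)
  is-uv? u v x y = (x ≟ u) ×-dec (y ≟ v)

  bump : Lengths → Fin (n T) → Fin (n T) → Lengths
  bump len u v x y with x ≟ u | y ≟ v
  ... | yes _ | yes _ = suc (len u v)
  ... | _ | _ = len x y

  bump-uv : ∀ len u v → bump len u v u v ≡ suc (len u v)
  bump-uv len u v with u ≟ u | v ≟ v
  ... | yes _ | yes _ = refl
  ... | no u≢u | _ = ⊥-elim (u≢u refl)
  ... | yes _ | no v≢v = ⊥-elim (v≢v refl)

  bump-other : ∀ len u v x y → ¬ (x ≡ u × y ≡ v) → bump len u v x y ≡ len x y
  bump-other len u v x y h with x ≟ u | y ≟ v
  ... | yes p | yes q = ⊥-elim (h (p , q))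
  ... | no _ | _ = refl
  ... | yes _ | no _ = refl

  bump-≤ : ∀ len u v x y → len x y ≤ bump len u v x y
  bump-≤ len u v x y with is-uv? u v x y
  ... | yes (refl , refl) = ℕₚ.≤-trans (ℕₚ.n≤1+n _) (ℕₚ.≤-reflexive (≡.sym (bump-uv len x y)))
  ... | no h = ℕₚ.≤-reflexive (≡.sym (bump-other len u v x y h))

  -- Adding one new vertex on the edge uv (u < v) of a coordinatised
  -- subdivision: subdivide the last edge of the uv-path, the one ending in v.
  module AddVertex (S : Subdivided) (u v : Fin (n T)) (uv : Adj T u v) (u<v : toℕ u < toℕ v) where
    open Subdivided S

    l₀ : ℕ
    l₀ = len u v

    len' : Lengths
    len' = bump len u v

    -- The label of the neighbour of v on the uv-path when it carries m new vertices.
    before-v : ℕ → Label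
    before-v zero = orig u
    before-v (suc p) = mid u v p

    before-v-valid : ∀ m → m ≡ l₀ → Valid len (before-v m)
    before-v-valid zero eq = tt
    before-v-valid (suc p) eq = subst (suc p ≤_) eq ℕₚ.≤-refl

    x⁻ vᴳ : Fin (n G)
    x⁻ = vertex (before-v l₀) (before-v-valid l₀ refl)
    vᴳ = vertex (orig v) tt

    u≢v : u ≢ v
    u≢v refl = irrefl T uv

    before-v-adj : ∀ m → m ≡ l₀ → LAdj len (before-v m) (orig v)
    before-v-adj zero eq = uv , ≡.sym eq , oriented v u (ℕₚ.<⇒≤ u<v)
    before-v-adj (suc p) eq = inj₂ (refl , eq)

    x⁻vᴳ : Adj G x⁻ vᴳ
    x⁻vᴳ = proj₂ (adj x⁻ vᴳ)
      (subst₂ (LAdj len) (≡.sym (label-vertex (before-v l₀) _)) (≡.sym (label-vertex (orig v) tt)) (before-v-adj l₀ refl))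

    G' : Graph
    G' = subdivide G x⁻ vᴳ

    label' : Fin (suc (n G)) → Label
    label' a = fromView (view a)
      where
      fromView : ∀ {a} → View a → Label
      fromView ‵fromℕ = mid u v l₀
      fromView (‵inject₁ x) = label x

    label'-old : ∀ x → label' (inject₁ x) ≡ label x
    label'-old x rewrite view-inject₁ x = refl

    label'-new : label' (fromℕ (n G)) ≡ mid u v l₀
    label'-new rewrite view-fromℕ (n G) = refl

    valid-mono : ∀ l → Valid len l → Valid len' l
    valid-mono (orig x) w = tt
    valid-mono (mid a b p) w = ℕₚ.<-≤-trans w (bump-≤ len u v a b)

    valid-new : Valid len' (mid u v l₀)
    valid-new = subst (suc l₀ ≤_) (≡.sym (bump-uv len u v)) ℕₚ.≤-refl

    valid' : ∀ a → Valid len' (label' a)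
    valid' a with view a
    ... | ‵fromℕ = valid-new
    ... | ‵inject₁ x = valid-mono (label x) (valid x)

    valid-old : ∀ l → Valid len' l → l ≢ mid u v l₀ → Valid len l
    valid-old (orig x) w ne = tt
    valid-old (mid a b p) w ne with is-uv? u v a b
    ... | yes (refl , refl) = ℕₚ.≤∧≢⇒< (s≤s⁻¹ (subst (suc p ≤_) (bump-uv len u v) w)) (λ eq → ne (cong (mid u v) eq))
    ... | no h = subst (suc p ≤_) (bump-other len u v a b h) w

    vertex' : (l : Label) → .(Valid len' l) → Fin (suc (n G))
    vertex' l w with l ≟ₗ mid u v l₀
    ... | yes _ = fromℕ (n G)
    ... | no ne = inject₁ (vertex l (valid-old l w ne))

    label-vertex' : ∀ l .(w : Valid len' l) → label' (vertex' l w) ≡ l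
    label-vertex' l w with l ≟ₗ mid u v l₀
    ... | yes eq = trans label'-new (≡.sym eq)
    ... | no ne = trans (label'-old _) (label-vertex l _)

    vertex-unique' : ∀ a l → label' a ≡ l → .(w : Valid len' l) → vertex' l w ≡ a
    vertex-unique' a l eq w with l ≟ₗ mid u v l₀ | view a
    ... | yes _ | ‵fromℕ = refl
    ... | yes refl | ‵inject₁ x = ⊥-elim (ℕₚ.<-irrefl refl (subst (Valid len) eq (valid x)))
    ... | no ne | ‵fromℕ = ⊥-elim (ne (≡.sym eq))
    ... | no ne | ‵inject₁ x = cong inject₁ (vertex-unique x l eq _)

    keep : ∀ l₁ l₂ → LAdj len l₁ l₂ → ¬ (l₁ ≡ before-v l₀ × l₂ ≡ orig v) → ¬ (l₁ ≡ orig v × l₂ ≡ before-v l₀)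
         → LAdj len' l₁ l₂
    keep (orig x) (orig y) (a , lx , ly) n₁ n₂ = a , k₁ , k₂
      where
      k₁ : len' x y ≡ 0
      k₁ with is-uv? u v x y
      ... | yes (refl , refl) = ⊥-elim (n₁ (cong before-v (≡.sym lx) , refl))
      ... | no h = trans (bump-other len u v x y h) lx
      k₂ : len' y x ≡ 0
      k₂ with is-uv? u v y x
      ... | yes (refl , refl) = ⊥-elim (n₂ (refl , cong before-v (≡.sym ly)))
      ... | no h = trans (bump-other len u v y x h) ly
    keep (orig x) (mid a b p) (inj₁ h) n₁ n₂ = inj₁ h
    keep (orig x) (mid a b p) (inj₂ (xb , sp)) n₁ n₂ with is-uv? u v a b
    ... | yes (refl , refl) = ⊥-elim (n₂ (cong orig xb , cong before-v sp))
    ... | no h = inj₂ (xb , trans sp (≡.sym (bump-other len u v a b h)))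
    keep (mid a b p) (orig x) (inj₁ h) n₁ n₂ = inj₁ h
    keep (mid a b p) (orig x) (inj₂ (xb , sp)) n₁ n₂ with is-uv? u v a b
    ... | yes (refl , refl) = ⊥-elim (n₁ (cong before-v sp , cong orig xb))
    ... | no h = inj₂ (xb , trans sp (≡.sym (bump-other len u v a b h)))
    keep (mid a b p) (mid a' b' p') h n₁ n₂ = h

    restore : ∀ l₁ l₂ → LAdj len' l₁ l₂ → Valid len l₁ → Valid len l₂ → LAdj len l₁ l₂
    restore (orig x) (orig y) (a , lx , ly) _ _ = a , k₁ , k₂
      where
      k₁ : len x y ≡ 0
      k₁ with is-uv? u v x y
      ... | yes (refl , refl) = ⊥-elim (ℕₚ.1+n≢0 (trans (≡.sym (bump-uv len u v)) lx))
      ... | no h = trans (≡.sym (bump-other len u v x y h)) lx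
      k₂ : len y x ≡ 0
      k₂ with is-uv? u v y x
      ... | yes (refl , refl) = ⊥-elim (ℕₚ.1+n≢0 (trans (≡.sym (bump-uv len u v)) ly))
      ... | no h = trans (≡.sym (bump-other len u v y x h)) ly
    restore (orig x) (mid a b p) (inj₁ h) _ _ = inj₁ h
    restore (orig x) (mid a b p) (inj₂ (xb , sp)) _ w with is-uv? u v a b
    ... | yes (refl , refl) = ⊥-elim (ℕₚ.<-irrefl (ℕₚ.suc-injective (trans sp (bump-uv len u v))) w)
    ... | no h = inj₂ (xb , trans sp (bump-other len u v a b h))
    restore (mid a b p) (orig x) (inj₁ h) _ _ = inj₁ h
    restore (mid a b p) (orig x) (inj₂ (xb , sp)) w _ with is-uv? u v a b
    ... | yes (refl , refl) = ⊥-elim (ℕₚ.<-irrefl (ℕₚ.suc-injective (trans sp (bump-uv len u v))) w)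
    ... | no h = inj₂ (xb , trans sp (bump-other len u v a b h))
    restore (mid a b p) (mid a' b' p') h _ _ = h

    x⁻-not-v : ∀ m → m ≡ l₀ → ¬ LAdj len' (before-v m) (orig v)
    x⁻-not-v zero eq (_ , l , _) = ℕₚ.1+n≢0 (trans (≡.sym (bump-uv len u v)) l)
    x⁻-not-v (suc p) eq (inj₁ (vu , _)) = u≢v (≡.sym vu)
    x⁻-not-v (suc p) eq (inj₂ (_ , sp)) =
      ℕₚ.<-irrefl refl (subst (suc p <_) (≡.sym (trans sp (trans (bump-uv len u v) (cong suc (≡.sym eq))))) ℕₚ.≤-refl)

    x⁻-new : ∀ {L : Lengths} m → LAdj L (before-v m) (mid u v m)
    x⁻-new zero = inj₁ (refl , refl)
    x⁻-new (suc p) = refl , refl , inj₁ refl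

    new-neighbours : ∀ l → Valid len l → LAdj len' l (mid u v l₀) → (l ≡ before-v l₀) ⊎ (l ≡ orig v)
    new-neighbours (orig y) _ (inj₁ (refl , q)) = inj₁ (cong before-v (≡.sym q))
    new-neighbours (orig y) _ (inj₂ (refl , _)) = inj₂ refl
    new-neighbours (mid a b p) _ (refl , refl , inj₁ q) = inj₁ (cong before-v q)
    new-neighbours (mid a b p) w (refl , refl , inj₂ q) =
      ⊥-elim (ℕₚ.<-irrefl refl (ℕₚ.<-trans (subst (l₀ <_) q ℕₚ.≤-refl) w))

    new-adj : ∀ x → (x ≡ x⁻) ⊎ (x ≡ vᴳ) → LAdj len' (label x) (mid u v l₀)
    new-adj x (inj₁ refl) rewrite label-vertex (before-v l₀) (before-v-valid l₀ refl) = x⁻-new l₀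
    new-adj x (inj₂ refl) rewrite label-vertex (orig v) tt = inj₂ (refl , ≡.sym (bump-uv len u v))

    new-adj⁻¹ : ∀ x → LAdj len' (label x) (mid u v l₀) → (x ≡ x⁻) ⊎ (x ≡ vᴳ)
    new-adj⁻¹ x h with new-neighbours (label x) (valid x) h
    ... | inj₁ p = inj₁ (≡.sym (vertex-unique x _ p _))
    ... | inj₂ p = inj₂ (≡.sym (vertex-unique x _ p _))

    adj⇒LAdj : ∀ a b → SubAdj G x⁻ vᴳ a b → LAdj len' (label' a) (label' b)
    adj⇒LAdj .(inject₁ x) .(inject₁ y) (old x y refl refl e h) rewrite label'-old x | label'-old y =
      keep (label x) (label y) (proj₁ (adj x y) e)
        (λ { (p , q) → h (inj₁ (≡.sym (vertex-unique x _ p (before-v-valid l₀ refl)) , ≡.sym (vertex-unique y _ q tt))) })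
        (λ { (p , q) → h (inj₂ (≡.sym (vertex-unique x _ p tt) , ≡.sym (vertex-unique y _ q (before-v-valid l₀ refl)))) })
    adj⇒LAdj .(inject₁ x) .(fromℕ (n G)) (toNew x refl refl h) rewrite label'-old x | label'-new = new-adj x h
    adj⇒LAdj .(fromℕ (n G)) .(inject₁ x) (fromNew x refl refl h) rewrite label'-old x | label'-new =
      LAdj-sym (label x) (mid u v l₀) (new-adj x h)

    LAdj⇒adj : ∀ a b → LAdj len' (label' a) (label' b) → SubAdj G x⁻ vᴳ a b
    LAdj⇒adj a b h with view a | view b
    ... | ‵inject₁ x | ‵inject₁ y =
      old x y refl refl (proj₂ (adj x y) (restore (label x) (label y) h (valid x) (valid y))) not-x⁻vᴳ
      where
      not-x⁻vᴳ : ¬ ((x ≡ x⁻ × y ≡ vᴳ) ⊎ (x ≡ vᴳ × y ≡ x⁻))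
      not-x⁻vᴳ (inj₁ (refl , refl)) =
        x⁻-not-v l₀ refl (subst₂ (LAdj len') (label-vertex (before-v l₀) _) (label-vertex (orig v) tt) h)
      not-x⁻vᴳ (inj₂ (refl , refl)) =
        x⁻-not-v l₀ refl (LAdj-sym (orig v) (before-v l₀)
          (subst₂ (LAdj len') (label-vertex (orig v) tt) (label-vertex (before-v l₀) _) h))
    ... | ‵inject₁ x | ‵fromℕ = toNew x refl refl (new-adj⁻¹ x h)
    ... | ‵fromℕ | ‵inject₁ y =
      fromNew y refl refl (new-adj⁻¹ y (LAdj-sym (mid u v l₀) (label y) h))
    ... | ‵fromℕ | ‵fromℕ = ⊥-elim (no-loop h)
      where
      no-loop : LAdj len' (mid u v l₀) (mid u v l₀) → ⊥
      no-loop (_ , _ , inj₁ q) = ℕₚ.1+n≢n q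
      no-loop (_ , _ , inj₂ q) = ℕₚ.1+n≢n q

    next : Subdivided
    next = record
      { G = G'
      ; iter = step iter x⁻ vᴳ x⁻vᴳ
      ; tree = SubdivideEdge.subdivide-tree G x⁻ vᴳ x⁻vᴳ tree
      ; len = len'
      ; oriented = oriented'
      ; on-edge = on-edge'
      ; label = label' ; valid = valid' ; vertex = vertex'
      ; label-vertex = label-vertex'
      ; vertex-label = λ a → vertex-unique' a (label' a) refl (valid' a)
      ; adj = λ a b → adj⇒LAdj a b , LAdj⇒adj a b }
      where
      oriented' : ∀ x y → toℕ y ≤ toℕ x → len' x y ≡ 0
      oriented' x y le with is-uv? u v x y
      ... | yes (refl , refl) = ⊥-elim (ℕₚ.<-irrefl refl (ℕₚ.<-≤-trans u<v le))
      ... | no h = trans (bump-other len u v x y h) (oriented x y le)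
      on-edge' : ∀ x y → 0 < len' x y → Adj T x y
      on-edge' x y lt with is-uv? u v x y
      ... | yes (refl , refl) = uv
      ... | no h = on-edge x y (subst (0 <_) (bump-other len u v x y h) lt)

  add : (S : Subdivided) (u v : Fin (n T)) → Adj T u v → toℕ u < toℕ v → ℕ → Subdivided
  add S u v uv u<v zero = S
  add S u v uv u<v (suc m) = AddVertex.next (add S u v uv u<v m) u v uv u<v

  add-len-uv : ∀ S u v uv u<v m → Subdivided.len (add S u v uv u<v m) u v ≡ m + Subdivided.len S u v
  add-len-uv S u v uv u<v zero = refl
  add-len-uv S u v uv u<v (suc m) =
    trans (bump-uv (Subdivided.len (add S u v uv u<v m)) u v) (cong suc (add-len-uv S u v uv u<v m))

  add-len-other : ∀ S u v uv u<v m x y → ¬ (x ≡ u × y ≡ v) → Subdivided.len (add S u v uv u<v m) x y ≡ Subdivided.len S x y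
  add-len-other S u v uv u<v zero x y h = refl
  add-len-other S u v uv u<v (suc m) x y h =
    trans (bump-other (Subdivided.len (add S u v uv u<v m)) u v x y h) (add-len-other S u v uv u<v m x y h)

  module SubdivideAll (TT : IsTree T) (M : ℕ) (M≢0 : M ≢ 0) where
    open Subdivided using (len)

    Uniform : Subdivided → Set
    Uniform S = ∀ x y → len S x y ≡ 0 ⊎ len S x y ≡ M

    add-M-uniform : ∀ S u v uv u<v → Uniform S → len S u v ≡ 0 → Uniform (add S u v uv u<v M)
    add-M-uniform S u v uv u<v U z x y with is-uv? u v x y
    ... | yes (refl , refl) = inj₂ (trans (add-len-uv S u v uv u<v M) (trans (cong (M +_) z) (ℕₚ.+-identityʳ M)))
    ... | no h rewrite add-len-other S u v uv u<v M x y h = U x y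

    visit : Subdivided → Fin (n T) × Fin (n T) → Subdivided
    visit S (u , v) with toℕ u <? toℕ v | tree-adj? T TT u v | len S u v ℕₚ.≟ 0
    ... | yes u<v | yes uv | yes _ = add S u v uv u<v M
    ... | yes _   | yes _  | no _  = S
    ... | yes _   | no _   | _     = S
    ... | no _    | _      | _     = S

    visit-uniform : ∀ S p → Uniform S → Uniform (visit S p)
    visit-uniform S (u , v) U with toℕ u <? toℕ v | tree-adj? T TT u v | len S u v ℕₚ.≟ 0
    ... | yes u<v | yes uv | yes z = add-M-uniform S u v uv u<v U z
    ... | yes _   | yes _  | no _  = U
    ... | yes _   | no _   | _     = U
    ... | no _    | _      | _     = U

    visit-keeps : ∀ S p x y → len S x y ≡ M → len (visit S p) x y ≡ M
    visit-keeps S (u , v) x y h with toℕ u <? toℕ v | tree-adj? T TT u v | len S u v ℕₚ.≟ 0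
    ... | yes u<v | yes uv | yes z = kept
      where
      kept : len (add S u v uv u<v M) x y ≡ M
      kept with is-uv? u v x y
      ... | yes (refl , refl) = ⊥-elim (M≢0 (trans (≡.sym h) z))
      ... | no ne = trans (add-len-other S u v uv u<v M x y ne) h
    ... | yes _   | yes _  | no _  = h
    ... | yes _   | no _   | _     = h
    ... | no _    | _      | _     = h

    visit-done : ∀ S u v → Uniform S → toℕ u < toℕ v → Adj T u v → len (visit S (u , v)) u v ≡ M
    visit-done S u v U u<v' uv' with toℕ u <? toℕ v | tree-adj? T TT u v | len S u v ℕₚ.≟ 0
    ... | yes u<v | yes uv | yes z = trans (add-len-uv S u v uv u<v M) (trans (cong (M +_) z) (ℕₚ.+-identityʳ M))
    ... | yes _   | yes _  | no nz with U u v
    ...   | inj₁ z = ⊥-elim (nz z)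
    ...   | inj₂ m = m
    visit-done S u v U u<v' uv' | yes _ | no ¬uv | _ = ⊥-elim (¬uv uv')
    visit-done S u v U u<v' uv' | no ¬u<v | _ | _ = ⊥-elim (¬u<v u<v')

    visitAll : Subdivided → List (Fin (n T) × Fin (n T)) → Subdivided
    visitAll = foldl visit

    visitAll-uniform : ∀ S ps → Uniform S → Uniform (visitAll S ps)
    visitAll-uniform S [] U = U
    visitAll-uniform S (p ∷ ps) U = visitAll-uniform (visit S p) ps (visit-uniform S p U)

    visitAll-keeps : ∀ S ps x y → len S x y ≡ M → len (visitAll S ps) x y ≡ M
    visitAll-keeps S [] x y h = h
    visitAll-keeps S (p ∷ ps) x y h = visitAll-keeps (visit S p) ps x y (visit-keeps S p x y h)

    visitAll-done : ∀ S ps → Uniform S → ∀ u v → (u , v) ∈ₗ ps → toℕ u < toℕ v → Adj T u v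
                  → len (visitAll S ps) u v ≡ M
    visitAll-done S (p ∷ ps) U u v (here refl) u<v uv = visitAll-keeps (visit S p) ps u v (visit-done S u v U u<v uv)
    visitAll-done S (p ∷ ps) U u v (there m) u<v uv =
      visitAll-done (visit S p) ps (visit-uniform S p U) u v m u<v uv

    allPairs : List (Fin (n T) × Fin (n T))
    allPairs = cartesianProduct (allFin (n T)) (allFin (n T))

    subdivided : Subdivided
    subdivided = visitAll (unsubdivided TT) allPairs

    subdivided-uniform : Uniform subdivided
    subdivided-uniform = visitAll-uniform _ allPairs (λ _ _ → inj₁ refl)

    subdivided-edge : ∀ u v → Adj T u v → toℕ u < toℕ v → len subdivided u v ≡ M
    subdivided-edge u v uv u<v = visitAll-done _ allPairs (λ _ _ → inj₁ refl) u v
      (∈-cartesianProduct⁺ (∈-allFin u) (∈-allFin v)) u<v uv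

-- Every edge uv (u < v) of T is subdivided M times; position
-- q ∈ [0 , M + 1] on it is u for q = 0, v for q = M + 1 and mid u v (q - 1)
-- otherwise.  The positions 1 … M are split into four bands
--   A = [2 , b₁]   B = (b₁ , b₂)   C = (b₂ , b₃]   D = (b₃ , M),
-- and t' i occupies the interval [lo , hi] of positions on each edge uv:
--   lo = 0 (u inner), A-position of i (u ∈ t i a leaf of T), C-position
--   of i (only v ∈ t i), or past v (neither end in t i);
--   hi = M + 1 (v inner), D-position of i (v ∈ t i a leaf), B-position of
--   i (only u ∈ t i), or 0 (neither end in t i);
-- together with the inner vertices of T lying in t i.  The positions of i
-- in the bands are taken from its keys κ i and ρ i, so they are distinct for
-- distinct i and move outwards as the subtree grows.
module Construction (T : Graph) (TT : IsTree T) (two : 2 ≤ n T) (k : ℕ) (t : Fin k → Subset (n T))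
                    (st : ∀ i → IsSubtree T (t i)) where
  open Coordinates T
  open Keys t

  b₁ b₂ b₃ M : ℕ
  b₁ = suc K
  b₂ = suc b₁ + suc K
  b₃ = b₂ + K
  M = suc b₃ + K

  posA posB posC posD : Fin k → ℕ
  posA i = suc (ρ i)
  posB i = suc b₁ + κ i
  posC i = b₂ + ρ i
  posD i = suc b₃ + κ i

  A≤b₁ : ∀ i → posA i ≤ b₁
  A≤b₁ i = s≤s (ρ≤K i)

  b₁<B : ∀ i → b₁ < posB i
  b₁<B i = s≤s (ℕₚ.m≤m+n b₁ (κ i))

  B<b₂ : ∀ i → posB i < b₂
  B<b₂ i = ℕₚ.+-monoʳ-< (suc b₁) (ℕₚ.<-trans (κ<K i) (ℕₚ.n<1+n K))

  b₂<C : ∀ i → b₂ < posC i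
  b₂<C i = subst (_≤ b₂ + ρ i) (ℕₚ.+-comm b₂ 1) (ℕₚ.+-monoʳ-≤ b₂ (ρ≥1 i))

  C≤b₃ : ∀ i → posC i ≤ b₃
  C≤b₃ i = ℕₚ.+-monoʳ-≤ b₂ (ρ≤K i)

  b₃<D : ∀ i → b₃ < posD i
  b₃<D i = s≤s (ℕₚ.m≤m+n b₃ (κ i))

  D<M : ∀ i → posD i < M
  D<M i = ℕₚ.+-monoʳ-< (suc b₃) (κ<K i)

  2≤A : ∀ i → 2 ≤ posA i
  2≤A i = s≤s (ρ≥1 i)

  b₁≤b₂ : b₁ ≤ b₂
  b₁≤b₂ = ℕₚ.≤-trans (ℕₚ.n≤1+n b₁) (ℕₚ.m≤m+n (suc b₁) (suc K))

  b₂≤b₃ : b₂ ≤ b₃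
  b₂≤b₃ = ℕₚ.m≤m+n b₂ K

  b₁≤b₃ : b₁ ≤ b₃
  b₁≤b₃ = ℕₚ.≤-trans b₁≤b₂ b₂≤b₃

  b₃<M : b₃ < M
  b₃<M = ℕₚ.m≤m+n (suc b₃) K

  b₃≤M : b₃ ≤ M
  b₃≤M = ℕₚ.<⇒≤ b₃<M

  b₁≤M+1 : b₁ ≤ suc M
  b₁≤M+1 = ℕₚ.≤-trans (ℕₚ.≤-trans b₁≤b₃ b₃≤M) (ℕₚ.n≤1+n M)

  -- The ends of the interval of t i on the edge uv.  They are opaque:
  -- only the eight equations below, one per case, are used.
  opaque
    lo hi : Fin (n T) → Fin (n T) → Fin k → ℕ
    lo u v i = if does (u ∈? t i) then (if does (inner? T TT u) then 0 else posA i)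
               else (if does (v ∈? t i) then posC i else suc (suc M))
    hi u v i = if does (v ∈? t i) then (if does (inner? T TT v) then suc M else posD i)
               else (if does (u ∈? t i) then posB i else 0)

  In : Fin (n T) → Fin (n T) → Fin k → ℕ → Set
  In u v i q = lo u v i ≤ q × q ≤ hi u v i

  In? : ∀ u v i q → Dec (In u v i q)
  In? u v i q = (lo u v i ≤? q) ×-dec (q ≤? hi u v i)

  dec-cases : ∀ {P A : Set} → Dec P → (P → A) → (¬ P → A) → A
  dec-cases (yes p) f g = f p
  dec-cases (no p) f g = g p

  module _ {u v : Fin (n T)} {i : Fin k} where
    opaque
      unfolding lo

      lo-inner : u ∈ t i → Inner T u → lo u v i ≡ 0
      lo-inner u∈ inner rewrite dec-true (u ∈? t i) u∈ | dec-true (inner? T TT u) inner = refl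

      lo-leaf : u ∈ t i → ¬ Inner T u → lo u v i ≡ posA i
      lo-leaf u∈ leaf rewrite dec-true (u ∈? t i) u∈ | dec-false (inner? T TT u) leaf = refl

      lo-only-v : u ∉ t i → v ∈ t i → lo u v i ≡ posC i
      lo-only-v u∉ v∈ rewrite dec-false (u ∈? t i) u∉ | dec-true (v ∈? t i) v∈ = refl

      lo-none : u ∉ t i → v ∉ t i → lo u v i ≡ suc (suc M)
      lo-none u∉ v∉ rewrite dec-false (u ∈? t i) u∉ | dec-false (v ∈? t i) v∉ = refl

      hi-inner : v ∈ t i → Inner T v → hi u v i ≡ suc M
      hi-inner v∈ inner rewrite dec-true (v ∈? t i) v∈ | dec-true (inner? T TT v) inner = refl

      hi-leaf : v ∈ t i → ¬ Inner T v → hi u v i ≡ posD i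
      hi-leaf v∈ leaf rewrite dec-true (v ∈? t i) v∈ | dec-false (inner? T TT v) leaf = refl

      hi-only-u : v ∉ t i → u ∈ t i → hi u v i ≡ posB i
      hi-only-u v∉ u∈ rewrite dec-false (v ∈? t i) v∉ | dec-true (u ∈? t i) u∈ = refl

      hi-none : v ∉ t i → u ∉ t i → hi u v i ≡ 0
      hi-none v∉ u∉ rewrite dec-false (v ∈? t i) v∉ | dec-false (u ∈? t i) u∉ = refl


  module _ {u v : Fin (n T)} {i : Fin k} where
    lo≤b₁ : u ∈ t i → lo u v i ≤ b₁
    lo≤b₁ h = dec-cases (inner? T TT u)
      (λ nl → subst (_≤ b₁) (≡.sym (lo-inner h nl)) z≤n)
      (λ nl → subst (_≤ b₁) (≡.sym (lo-leaf h nl)) (A≤b₁ i))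

    lo≤b₃ : v ∈ t i → lo u v i ≤ b₃
    lo≤b₃ h = dec-cases (u ∈? t i)
      (λ hu → ℕₚ.≤-trans (lo≤b₁ hu) b₁≤b₃)
      (λ hu → subst (_≤ b₃) (≡.sym (lo-only-v hu h)) (C≤b₃ i))

    lo>b₁ : u ∉ t i → b₁ < lo u v i
    lo>b₁ h = dec-cases (v ∈? t i)
      (λ hv → subst (b₁ <_) (≡.sym (lo-only-v h hv)) (ℕₚ.≤-<-trans b₁≤b₂ (b₂<C i)))
      (λ hv → subst (b₁ <_) (≡.sym (lo-none h hv)) (s≤s (ℕₚ.≤-trans b₁≤b₃ (ℕₚ.≤-trans b₃≤M (ℕₚ.n≤1+n M)))))

    hi>b₃ : v ∈ t i → suc b₃ ≤ hi u v i
    hi>b₃ h = dec-cases (inner? T TT v)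
      (λ nl → subst (suc b₃ ≤_) (≡.sym (hi-inner h nl)) (s≤s b₃≤M))
      (λ nl → subst (suc b₃ ≤_) (≡.sym (hi-leaf h nl)) (b₃<D i))

    hi>b₁ : u ∈ t i → suc b₁ ≤ hi u v i
    hi>b₁ h = dec-cases (v ∈? t i)
      (λ hv → ℕₚ.≤-trans (s≤s b₁≤b₃) (hi>b₃ hv))
      (λ hv → subst (suc b₁ ≤_) (≡.sym (hi-only-u hv h)) (b₁<B i))

    hi≤b₃ : v ∉ t i → hi u v i < suc b₃
    hi≤b₃ h = dec-cases (u ∈? t i)
      (λ hu → subst (_< suc b₃) (≡.sym (hi-only-u h hu)) (s≤s (ℕₚ.≤-trans (ℕₚ.<⇒≤ (B<b₂ i)) b₂≤b₃)))
      (λ hu → subst (_< suc b₃) (≡.sym (hi-none h hu)) (s≤s z≤n))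

    hi≤M+1 : hi u v i ≤ suc M
    hi≤M+1 = dec-cases (v ∈? t i)
      (λ hv → dec-cases (inner? T TT v)
        (λ nl → ℕₚ.≤-reflexive (hi-inner hv nl))
        (λ nl → subst (_≤ suc M) (≡.sym (hi-leaf hv nl)) (ℕₚ.≤-trans (ℕₚ.<⇒≤ (D<M i)) (ℕₚ.n≤1+n M))))
      (λ hv → ℕₚ.<⇒≤ (ℕₚ.<-≤-trans (hi≤b₃ hv) (s≤s b₃≤M)))

    In⇒meets : ∀ {q} → In u v i q → u ∈ t i ⊎ v ∈ t i
    In⇒meets {q} (l , h) = dec-cases (u ∈? t i) inj₁ λ a → dec-cases (v ∈? t i) inj₂ λ b →
      ⊥-elim (ℕₚ.<-irrefl refl
          (ℕₚ.≤-trans (subst (_≤ q) (lo-none a b) l) (ℕₚ.≤-trans (subst (q ≤_) (hi-none b a) h) z≤n)))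

    In⇒≤M+1 : ∀ {q} → In u v i q → q ≤ suc M
    In⇒≤M+1 (_ , h) = ℕₚ.≤-trans h hi≤M+1

    In-convex : ∀ {q₁ q₂ q} → In u v i q₁ → In u v i q₂ → q₁ ≤ q → q ≤ q₂ → In u v i q
    In-convex (l₁ , _) (_ , h₂) a b = ℕₚ.≤-trans l₁ a , ℕₚ.≤-trans b h₂

  In-mono : ∀ u v i j q → t i ⊆ t j → κ i ≤ κ j → In u v i q → In u v j q
  In-mono u v i j q ti⊆tj κi≤κj ih@(l , h) = ℕₚ.≤-trans lo-shrinks l , ℕₚ.≤-trans h hi-grows
    where
    lo-shrinks-u : u ∈ t i → lo u v j ≤ lo u v i
    lo-shrinks-u hu = dec-cases (inner? T TT u)
      (λ nl → subst₂ _≤_ (≡.sym (lo-inner (ti⊆tj hu) nl)) (≡.sym (lo-inner hu nl)) z≤n)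
      (λ nl → subst₂ _≤_ (≡.sym (lo-leaf (ti⊆tj hu) nl)) (≡.sym (lo-leaf hu nl)) (s≤s (ρ-antitone i j κi≤κj)))
    lo-shrinks : lo u v j ≤ lo u v i
    lo-shrinks with In⇒meets ih
    ... | inj₁ hu = lo-shrinks-u hu
    ... | inj₂ hv = dec-cases (u ∈? t i) lo-shrinks-u λ hu → dec-cases (u ∈? t j)
      (λ hu' → ℕₚ.≤-trans (lo≤b₁ hu') (subst (b₁ ≤_) (≡.sym (lo-only-v hu hv)) (ℕₚ.<⇒≤ (ℕₚ.≤-<-trans b₁≤b₂ (b₂<C i)))))
      (λ hu' → subst₂ _≤_ (≡.sym (lo-only-v hu' (ti⊆tj hv))) (≡.sym (lo-only-v hu hv)) (ℕₚ.+-monoʳ-≤ b₂ (ρ-antitone i j κi≤κj)))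
    hi-grows-v : v ∈ t i → hi u v i ≤ hi u v j
    hi-grows-v hv = dec-cases (inner? T TT v)
      (λ nl → subst₂ _≤_ (≡.sym (hi-inner hv nl)) (≡.sym (hi-inner (ti⊆tj hv) nl)) ℕₚ.≤-refl)
      (λ nl → subst₂ _≤_ (≡.sym (hi-leaf hv nl)) (≡.sym (hi-leaf (ti⊆tj hv) nl)) (ℕₚ.+-monoʳ-≤ (suc b₃) κi≤κj))
    hi-grows : hi u v i ≤ hi u v j
    hi-grows with In⇒meets ih
    ... | inj₂ hv = hi-grows-v hv
    ... | inj₁ hu = dec-cases (v ∈? t i) hi-grows-v λ hv → dec-cases (v ∈? t j)
      (λ hv' → ℕₚ.≤-trans (ℕₚ.<⇒≤ (hi≤b₃ hv)) (hi>b₃ hv'))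
      (λ hv' → subst₂ _≤_ (≡.sym (hi-only-u hv hu)) (≡.sym (hi-only-u hv' (ti⊆tj hu))) (ℕₚ.+-monoʳ-≤ (suc b₁) κi≤κj))

  -- If t i contains only u and t j only v, their intervals are disjoint
  -- (the first ends in band B, the second starts in band C).
  split-intervals-disjoint : ∀ u v i j q → u ∈ t i → v ∉ t i → u ∉ t j → v ∈ t j
                           → In u v i q → In u v j q → ⊥
  split-intervals-disjoint u v i j q ui vi uj vj (_ , h) (l , _) = ℕₚ.<-irrefl refl (ℕₚ.<-≤-trans
      (ℕₚ.<-trans (subst (_< b₂) (≡.sym (hi-only-u vi ui)) (B<b₂ i)) (b₂<C j))
      (ℕₚ.≤-trans (subst (_≤ q) (lo-only-v uj vj) l) h))

  shared-interval⇒meet : ∀ u v i j q → In u v i q → In u v j q → ∃[ x ] (x ∈ t i × x ∈ t j)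
  shared-interval⇒meet u v i j q ii ij = by-cases (u ∈? t i) (u ∈? t j) (v ∈? t i) (v ∈? t j)
    where
    neither : ∀ {l} → u ∈ t l ⊎ v ∈ t l → u ∉ t l → v ∉ t l → ⊥
    neither (inj₁ h) ul vl = ul h
    neither (inj₂ h) ul vl = vl h
    by-cases : Dec (u ∈ t i) → Dec (u ∈ t j) → Dec (v ∈ t i) → Dec (v ∈ t j) → ∃[ x ] (x ∈ t i × x ∈ t j)
    by-cases (yes ui) (yes uj) _        _        = u , ui , uj
    by-cases _        _        (yes vi) (yes vj) = v , vi , vj
    by-cases (yes ui) (no uj)  (no vi)  (yes vj) = ⊥-elim (split-intervals-disjoint u v i j q ui vi uj vj ii ij)
    by-cases (no ui)  (yes uj) (yes vi) (no vj)  = ⊥-elim (split-intervals-disjoint u v j i q uj vj ui vi ij ii)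
    by-cases (no ui)  _        (no vi)  _        = ⊥-elim (neither (In⇒meets ii) ui vi)
    by-cases _        (no uj)  _        (no vj)  = ⊥-elim (neither (In⇒meets ij) uj vj)

  -- The band of a position
  -- is determined by the position, and within a band the position
  -- determines i: so the special positions of distinct subtrees differ.
  data Band : Set where
    bandA bandB bandC bandD : Band

  special : Band → Fin k → ℕ
  special bandA = posA
  special bandB = posB
  special bandC = posC
  special bandD = posD

  opaque
    band : ℕ → Band
    band q = if does (q ≤? b₁) then bandA else if does (q ≤? b₂) then bandB
             else if does (q ≤? b₃) then bandC else bandD

  opaque
    unfolding band

    band-special : ∀ r i → band (special r i) ≡ r
    band-special bandA i rewrite dec-true (posA i ≤? b₁) (A≤b₁ i) = refl
    band-special bandB i
      rewrite dec-false (posB i ≤? b₁) (ℕₚ.<⇒≱ (b₁<B i)) | dec-true (posB i ≤? b₂) (ℕₚ.<⇒≤ (B<b₂ i)) = refl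
    band-special bandC i
      rewrite dec-false (posC i ≤? b₁) (ℕₚ.<⇒≱ (ℕₚ.≤-<-trans b₁≤b₂ (b₂<C i)))
            | dec-false (posC i ≤? b₂) (ℕₚ.<⇒≱ (b₂<C i)) | dec-true (posC i ≤? b₃) (C≤b₃ i) = refl
    band-special bandD i
      rewrite dec-false (posD i ≤? b₁) (ℕₚ.<⇒≱ (ℕₚ.≤-<-trans b₁≤b₃ (b₃<D i)))
            | dec-false (posD i ≤? b₂) (ℕₚ.<⇒≱ (ℕₚ.≤-<-trans b₂≤b₃ (b₃<D i)))
            | dec-false (posD i ≤? b₃) (ℕₚ.<⇒≱ (b₃<D i)) = refl

  special-injective : ∀ r i j → special r i ≡ special r j → i ≡ j
  special-injective bandA i j eq = ρ-injective i j (ℕₚ.suc-injective eq)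
  special-injective bandB i j eq = κ-injective i j (ℕₚ.+-cancelˡ-≡ (suc b₁) _ _ eq)
  special-injective bandC i j eq = ρ-injective i j (ℕₚ.+-cancelˡ-≡ b₂ _ _ eq)
  special-injective bandD i j eq = κ-injective i j (ℕₚ.+-cancelˡ-≡ (suc b₃) _ _ eq)

  special-determines : ∀ r r' i j → special r i ≡ special r' j → i ≡ j
  special-determines r r' i j eq with trans (≡.sym (band-special r i)) (trans (cong band eq) (band-special r' j))
  ... | refl = special-injective r i j eq

  IsSpecial : Fin k → ℕ → Set
  IsSpecial i q = Σ Band λ r → special r i ≡ q

  module _ {u v : Fin (n T)} {i : Fin k} {q : ℕ} (q≥1 : 1 ≤ q) (q≤M : q ≤ M) where
    lo-special : lo u v i ≡ q → IsSpecial i q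
    lo-special eq = dec-cases (u ∈? t i)
      (λ hu → dec-cases (inner? T TT u)
        (λ nl → ⊥-elim (ℕₚ.<-irrefl (trans (≡.sym (lo-inner hu nl)) eq) q≥1))
        (λ nl → bandA , trans (≡.sym (lo-leaf hu nl)) eq))
      (λ hu → dec-cases (v ∈? t i)
        (λ hv → bandC , trans (≡.sym (lo-only-v hu hv)) eq)
        (λ hv → ⊥-elim (ℕₚ.<⇒≱ (s≤s (ℕₚ.≤-trans q≤M (ℕₚ.n≤1+n M))) (ℕₚ.≤-reflexive (trans (≡.sym (lo-none hu hv)) eq)))))

    hi-special : hi u v i ≡ q → IsSpecial i q
    hi-special eq = dec-cases (v ∈? t i)
      (λ hv → dec-cases (inner? T TT v)
        (λ nl → ⊥-elim (ℕₚ.<⇒≱ (s≤s q≤M) (ℕₚ.≤-reflexive (trans (≡.sym (hi-inner hv nl)) eq))))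
        (λ nl → bandD , trans (≡.sym (hi-leaf hv nl)) eq))
      (λ hv → dec-cases (u ∈? t i)
        (λ hu → bandB , trans (≡.sym (hi-only-u hv hu)) eq)
        (λ hu → ⊥-elim (ℕₚ.<-irrefl (trans (≡.sym (hi-none hv hu)) eq) q≥1)))

  M≢0 : M ≢ 0
  M≢0 ()

  open SubdivideAll TT M M≢0
  module S = Subdivided subdivided
  open S using (G; len; label; vertex; label-vertex; vertex-label; valid)

  InLabel : Fin k → Label → Set
  InLabel i (orig x) = Inner T x × x ∈ t i
  InLabel i (mid u v p) = In u v i (suc p)

  inLabel? : ∀ i l → Dec (InLabel i l)
  inLabel? i (orig x) = inner? T TT x ×-dec (x ∈? t i)
  inLabel? i (mid u v p) = In? u v i (suc p)

  t' : Fin k → Subset (n G)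
  t' i = subsetOf (λ a → inLabel? i (label a))

  ∈t'⇒ : ∀ {i a} → a ∈ t' i → InLabel i (label a)
  ∈t'⇒ {i} = ∈subsetOf⁻ (λ a → inLabel? i (label a))

  ⇒∈t' : ∀ {i a} → InLabel i (label a) → a ∈ t' i
  ⇒∈t' {i} = ∈subsetOf⁺ (λ a → inLabel? i (label a))

  ∈t'-of-label : ∀ {i} a l → label a ≡ l → InLabel i l → a ∈ t' i
  ∈t'-of-label {i} a l eq m = ⇒∈t' (subst (InLabel i) (≡.sym eq) m)

  ∈t'-label : ∀ {i} a l → label a ≡ l → a ∈ t' i → InLabel i l
  ∈t'-label {i} a l eq m = subst (InLabel i) eq (∈t'⇒ m)

  mid-valid⇒edge : ∀ {u v p} → Valid len (mid u v p) → len u v ≡ M × Adj T u v × toℕ u < toℕ v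
  mid-valid⇒edge {u} {v} {p} w = lenM , S.on-edge u v (ℕₚ.≤-<-trans z≤n w) , lt
    where
    lenM : len u v ≡ M
    lenM with subdivided-uniform u v
    ... | inj₁ z = ⊥-elim (ℕₚ.n≮0 (subst (p <_) z w))
    ... | inj₂ m = m
    lt : toℕ u < toℕ v
    lt with ℕₚ.<-cmp (toℕ u) (toℕ v)
    ... | tri< a _ _ = a
    ... | tri≈ _ e _ = ⊥-elim (ℕₚ.n≮0 (subst (p <_) (S.oriented u v (ℕₚ.≤-reflexive (≡.sym e))) w))
    ... | tri> _ _ c = ⊥-elim (ℕₚ.n≮0 (subst (p <_) (S.oriented u v (ℕₚ.<⇒≤ c)) w))

  along : Fin (n T) → Fin (n T) → ℕ → Label
  along u v zero = orig u
  along u v (suc p) with p <? M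
  ... | yes _ = mid u v p
  ... | no _ = orig v

  along-mid : ∀ u v p → p < M → along u v (suc p) ≡ mid u v p
  along-mid u v p lt with p <? M
  ... | yes _ = refl
  ... | no n = ⊥-elim (n lt)

  along-end : ∀ u v → along u v (suc M) ≡ orig v
  along-end u v with M <? M
  ... | yes l = ⊥-elim (ℕₚ.<-irrefl refl l)
  ... | no _ = refl

  along-valid : ∀ u v q → len u v ≡ M → q ≤ suc M → Valid len (along u v q)
  along-valid u v zero eq le = tt
  along-valid u v (suc p) eq le with p <? M
  ... | yes lt = subst (p <_) (≡.sym eq) lt
  ... | no _ = tt

  pos : ∀ u v → .(len u v ≡ M) → (q : ℕ) → .(q ≤ suc M) → Fin (n G)
  pos u v eq q le = vertex (along u v q) (along-valid u v q eq le)

  label-pos : ∀ u v .(eq : len u v ≡ M) q .(le : q ≤ suc M) → label (pos u v eq q le) ≡ along u v q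
  label-pos u v eq q le = label-vertex (along u v q) _

  label-pos-mid : ∀ u v .(eq : len u v ≡ M) p .(le : suc p ≤ suc M) → p < M → label (pos u v eq (suc p) le) ≡ mid u v p
  label-pos-mid u v eq p le lt = trans (label-pos u v eq (suc p) le) (along-mid u v p lt)

  label-orig : ∀ x → label (vertex (orig x) tt) ≡ orig x
  label-orig x = label-vertex (orig x) tt

  along-∈ : ∀ u v i q → q ≤ suc M → In u v i q → InLabel i (along u v q)
  along-∈ u v i zero le (l , h) = dec-cases (u ∈? t i)
    (λ hu → dec-cases (inner? T TT u) (λ nl → nl , hu)
       (λ nl → ⊥-elim (ℕₚ.n≮0 (ℕₚ.≤-trans (2≤A i) (subst (_≤ 0) (lo-leaf hu nl) l)))))
    (λ hu → ⊥-elim (ℕₚ.n≮0 (ℕₚ.<-≤-trans (ℕₚ.≤-<-trans z≤n (lo>b₁ hu)) l)))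
  along-∈ u v i (suc p) le ih with p <? M
  ... | yes _ = ih
  ... | no np with ℕₚ.≤-antisym (s≤s⁻¹ le) (ℕₚ.≮⇒≥ np)
  ...   | refl = dec-cases (v ∈? t i)
    (λ hv → dec-cases (inner? T TT v) (λ nl → nl , hv)
       (λ nl → ⊥-elim (ℕₚ.<-irrefl refl (ℕₚ.<-trans (D<M i)
                 (subst (suc M ≤_) (hi-leaf hv nl) (proj₂ ih))))))
    (λ hv → ⊥-elim (ℕₚ.<-irrefl refl (ℕₚ.<-≤-trans (hi≤b₃ {u} {v} {i} hv)
                 (ℕₚ.≤-trans (s≤s b₃≤M) (proj₂ ih)))))

  along-∈⁻ : ∀ u v i q → q ≤ suc M → InLabel i (along u v q) → In u v i q
  along-∈⁻ u v i zero le (nl , hu) = ℕₚ.≤-reflexive (lo-inner hu nl) , z≤n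
  along-∈⁻ u v i (suc p) le h with p <? M
  ... | yes _ = h
  along-∈⁻ u v i (suc p) le (nl , hv) | no np with ℕₚ.≤-antisym (s≤s⁻¹ le) (ℕₚ.≮⇒≥ np)
  ...   | refl = ℕₚ.≤-trans (lo≤b₃ {u} {v} {i} hv) (ℕₚ.≤-trans b₃≤M (ℕₚ.n≤1+n M)) , ℕₚ.≤-reflexive (≡.sym (hi-inner {u} {v} {i} hv nl))

  along-adj : ∀ u v q → len u v ≡ M → q ≤ M → LAdj len (along u v q) (along u v (suc q))
  along-adj u v zero eq le rewrite along-mid u v 0 (ℕₚ.<-≤-trans (s≤s z≤n) (ℕₚ.≤-reflexive refl)) = inj₁ (refl , refl)
  along-adj u v (suc p) eq le rewrite along-mid u v p le with suc p <? M
  ... | yes lt = refl , refl , inj₁ refl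
  ... | no nl with ℕₚ.≤-antisym le (ℕₚ.≮⇒≥ nl)
  ...   | refl = inj₂ (refl , ≡.sym eq)

  vertex-cong : ∀ {l l'} → l ≡ l' → .(w : Valid len l) → .(w' : Valid len l') → vertex l w ≡ vertex l' w'
  vertex-cong refl w w' = refl

  pos-∈ : ∀ u v i .(eq : len u v ≡ M) q .(le : q ≤ suc M) → In u v i q → pos u v eq q le ∈ t' i
  pos-∈ u v i eq q le h = ⇒∈t' (subst (InLabel i) (≡.sym (label-pos u v eq q le)) (along-∈ u v i q (In⇒≤M+1 {u} {v} {i} h) h))

  pos-adj : ∀ u v (eq : len u v ≡ M) q .(le : q ≤ suc M) .(le' : suc q ≤ suc M) → q ≤ M
          → Adj G (pos u v eq q le) (pos u v eq (suc q) le')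
  pos-adj u v eq q le le' qM = proj₂ (S.adj _ _)
    (subst₂ (LAdj len) (≡.sym (label-pos u v eq q le)) (≡.sym (label-pos u v eq (suc q) le')) (along-adj u v q eq qM))

  -- The vertex representing x ∈ T: x itself when inner; for a leaf x with
  -- neighbour y the position b₁ (if x < y) or b₃ + 1 (if y < x) on the edge
  -- xy, which lies in t' i for every i with x ∈ t i.
  image : Fin (n T) → Fin (n G)
  image x with inner? T TT x | has-neighbour T TT two x
  ... | yes _ | _ = vertex (orig x) tt
  ... | no _ | (y , e) with ℕₚ.<-cmp (toℕ x) (toℕ y)
  ...   | tri< lt _ _ = pos x y (subdivided-edge x y e lt) b₁ b₁≤M+1
  ...   | tri≈ _ _ _ = vertex (orig x) tt
  ...   | tri> _ _ gt = pos y x (subdivided-edge y x (Graph.sym T e) gt) (suc b₃) (s≤s b₃≤M)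

  image-inner : ∀ {x} → Inner T x → image x ≡ vertex (orig x) tt
  image-inner {x} nl with inner? T TT x | has-neighbour T TT two x
  ... | yes _ | _ = refl
  ... | no n | _ = ⊥-elim (n nl)

  image-leaf-low : ∀ {x y} → ¬ Inner T x → (e : Adj T x y) → (lt : toℕ x < toℕ y)
                 → image x ≡ pos x y (subdivided-edge x y e lt) b₁ b₁≤M+1
  image-leaf-low {x} {y} nl e lt with inner? T TT x | has-neighbour T TT two x
  ... | yes n | _ = ⊥-elim (nl n)
  ... | no _ | (y' , e') with leaf-neighbour-unique T nl e' e
  ...   | refl with ℕₚ.<-cmp (toℕ x) (toℕ y')
  ...     | tri< _ _ _ = refl
  ...     | tri≈ _ c _ = ⊥-elim (ℕₚ.<-irrefl c lt)
  ...     | tri> _ _ c = ⊥-elim (ℕₚ.<-asym lt c)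

  image-leaf-high : ∀ {x y} → ¬ Inner T x → (e : Adj T y x) → (gt : toℕ y < toℕ x)
                  → image x ≡ pos y x (subdivided-edge y x e gt) (suc b₃) (s≤s b₃≤M)
  image-leaf-high {x} {y} nl e gt with inner? T TT x | has-neighbour T TT two x
  ... | yes n | _ = ⊥-elim (nl n)
  ... | no _ | (y' , e') with leaf-neighbour-unique T nl e' (Graph.sym T e)
  ...   | refl with ℕₚ.<-cmp (toℕ x) (toℕ y')
  ...     | tri< c _ _ = ⊥-elim (ℕₚ.<-asym gt c)
  ...     | tri≈ _ c _ = ⊥-elim (ℕₚ.<-irrefl (≡.sym c) gt)
  ...     | tri> _ _ _ = refl

  module WalksIn (i : Fin k) where

    walk-along : ∀ u v (eq : len u v ≡ M) q d → (le : d + q ≤ suc M) → In u v i q → In u v i (d + q)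
           → WalkIn G (t' i) (pos u v eq q (ℕₚ.≤-trans (ℕₚ.m≤n+m q d) le)) (pos u v eq (d + q) le)
    walk-along u v eq q zero le iq _ = nil (pos-∈ u v i eq q le iq)
    walk-along u v eq q (suc d) le iq iqd =
      walk-along u v eq q d le' iq iqd' ++ʷ
          (cons (pos-∈ u v i eq (d + q) le' iqd') (pos-adj u v eq (d + q) le' le (s≤s⁻¹ le)) (nil (pos-∈ u v i eq _ le iqd)))
      where
      le' : d + q ≤ suc M
      le' = ℕₚ.≤-trans (ℕₚ.n≤1+n _) le
      iqd' : In u v i (d + q)
      iqd' = In-convex {u} {v} {i} iq iqd (ℕₚ.m≤n+m q d) (ℕₚ.n≤1+n _)

    walk-between : ∀ u v (eq : len u v ≡ M) q1 q2 .(l1 : q1 ≤ suc M) .(l2 : q2 ≤ suc M)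
             → In u v i q1 → In u v i q2 → WalkIn G (t' i) (pos u v eq q1 l1) (pos u v eq q2 l2)
    walk-between u v eq q1 q2 l1 l2 i1 i2 with q1 ≤? q2
    ... | yes le = go (q2 ∸ q1) (ℕₚ.m∸n+n≡m le) i2
      where
      go : ∀ d → d + q1 ≡ q2 → In u v i q2 → WalkIn G (t' i) (pos u v eq q1 l1) (pos u v eq q2 l2)
      go d refl i2 = walk-along u v eq q1 d (In⇒≤M+1 {u} {v} {i} i2) i1 i2
    ... | no gt = reverseʷ (go (q1 ∸ q2) (ℕₚ.m∸n+n≡m (ℕₚ.<⇒≤ (ℕₚ.≰⇒> gt))) i1)
      where
      go : ∀ d → d + q2 ≡ q1 → In u v i q1 → WalkIn G (t' i) (pos u v eq q2 l2) (pos u v eq q1 l1)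
      go d refl i1 = walk-along u v eq q2 d (In⇒≤M+1 {u} {v} {i} i1) i2 i1


    Located : Fin (n T) → Fin (n T) → Fin (n T) → Set
    Located u v x = ∃[ q ] Σ (q ≤ suc M) λ le → (∀ (eq : len u v ≡ M) → image x ≡ pos u v eq q le) × In u v i q

    located-u : ∀ u v → Adj T u v → toℕ u < toℕ v → u ∈ t i → Located u v u
    located-u u v e lt hu = dec-cases (inner? T TT u)
      (λ nl → 0 , z≤n , (λ eq → image-inner nl) , ℕₚ.≤-reflexive (lo-inner {u} {v} {i} hu nl) , z≤n)
      (λ nl → b₁ , b₁≤M+1 , (λ eq → image-leaf-low nl e lt)
              , subst (_≤ b₁) (≡.sym (lo-leaf {u} {v} {i} hu nl)) (A≤b₁ i)
              , ℕₚ.≤-trans (ℕₚ.n≤1+n b₁) (hi>b₁ {u} {v} {i} hu))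

    located-v : ∀ u v → Adj T u v → toℕ u < toℕ v → v ∈ t i → Located u v v
    located-v u v e lt hv = dec-cases (inner? T TT v)
      (λ nl → suc M , ℕₚ.≤-refl
              , (λ eq → trans (image-inner nl) (vertex-cong (≡.sym (along-end u v)) _ _))
              , ℕₚ.≤-trans (lo≤b₃ {u} {v} {i} hv) (ℕₚ.≤-trans b₃≤M (ℕₚ.n≤1+n M))
              , ℕₚ.≤-reflexive (≡.sym (hi-inner {u} {v} {i} hv nl)))
      (λ nl → suc b₃ , s≤s b₃≤M , (λ eq → image-leaf-high nl e lt)
              , ℕₚ.≤-trans (lo≤b₃ {u} {v} {i} hv) (ℕₚ.n≤1+n b₃)
              , hi>b₃ {u} {v} {i} hv)

    walk-located : ∀ u v x y → (eq : len u v ≡ M) → Located u v x → Located u v y → WalkIn G (t' i) (image x) (image y)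
    walk-located u v x y eq (q1 , l1 , ex , i1) (q2 , l2 , ey , i2) =
      subst₂ (WalkIn G (t' i)) (≡.sym (ex eq)) (≡.sym (ey eq)) (walk-between u v eq q1 q2 l1 l2 i1 i2)

    edge-walk : ∀ {a b} → Adj T a b → a ∈ t i → b ∈ t i → WalkIn G (t' i) (image a) (image b)
    edge-walk {a} {b} e ha hb with ℕₚ.<-cmp (toℕ a) (toℕ b)
    ... | tri< lt _ _ = walk-located a b a b (subdivided-edge a b e lt) (located-u a b e lt ha) (located-v a b e lt hb)
    ... | tri> _ _ gt = walk-located b a a b (subdivided-edge b a (Graph.sym T e) gt) (located-v b a (Graph.sym T e) gt ha) (located-u b a (Graph.sym T e) gt hb)
    ... | tri≈ _ c _ with Finₚ.toℕ-injective c
    ...   | refl = ⊥-elim (irrefl T e)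

    image-∈ : ∀ {x} → x ∈ t i → image x ∈ t' i
    image-∈ {x} hx = helper (has-neighbour T TT two x)
      where
      helper : ∃[ y ] Adj T x y → image x ∈ t' i
      helper (y , e) with ℕₚ.<-cmp (toℕ x) (toℕ y)
      ... | tri< lt _ _ = walkStart (walk-located x y x x (subdivided-edge x y e lt) (located-u x y e lt hx) (located-u x y e lt hx))
      ... | tri> _ _ gt = walkStart (walk-located y x x x (subdivided-edge y x (Graph.sym T e) gt) (located-v y x (Graph.sym T e) gt hx) (located-v y x (Graph.sym T e) gt hx))
      ... | tri≈ _ c _ with Finₚ.toℕ-injective c
      ...   | refl = ⊥-elim (irrefl T e)

    map-walk : ∀ {x y} → WalkIn T (t i) x y → WalkIn G (t' i) (image x) (image y)
    map-walk (nil hx) = nil (image-∈ hx)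
    map-walk (cons hx e w) = edge-walk e hx (walkStart w) ++ʷ map-walk w

    reach-image : ∀ a → a ∈ t' i → ∃[ x ] (x ∈ t i × WalkIn G (t' i) a (image x))
    reach-image a ha = go (label a) refl (∈t'⇒ ha) (valid a)
      where
      go : ∀ l → label a ≡ l → InLabel i l → Valid len l → ∃[ x ] (x ∈ t i × WalkIn G (t' i) a (image x))
      go (orig x) eq (nl , hx) _ = x , hx , subst (WalkIn G (t' i) a) (≡.sym (trans (image-inner nl) (S.vertex-unique a _ eq tt))) (nil ha)
      go (mid u v p) eq ih w with mid-valid⇒edge w
      ... | lenM , e , lt = dec-cases (u ∈? t i)
          (λ hu → u , hu , walkPos' (located-u u v e lt hu))
          (λ hu → v , vIn hu , walkPos' (located-v u v e lt (vIn hu)))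
        where
        vIn : ¬ (u ∈ t i) → v ∈ t i
        vIn hu with In⇒meets ih
        ... | inj₁ x = ⊥-elim (hu x)
        ... | inj₂ x = x
        pa : p < M
        pa = subst (p <_) lenM w
        aEq : a ≡ pos u v lenM (suc p) (ℕₚ.≤-trans pa (ℕₚ.n≤1+n M))
        aEq = ≡.sym (S.vertex-unique a _ (trans eq (≡.sym (along-mid u v p pa))) _)
        walkPos' : ∀ {x} → Located u v x → WalkIn G (t' i) a (image x)
        walkPos' (q , l , ex , iq) = subst₂ (WalkIn G (t' i)) (≡.sym aEq) (≡.sym (ex lenM))
          (walk-between u v lenM (suc p) q (ℕₚ.≤-trans pa (ℕₚ.n≤1+n M)) l ih iq)

  -- Each t' i is a subtree: connected through images of walks in t i, and
  -- acyclic as a vertex set of the tree G.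
  subtree' : ∀ i → IsSubtree G (t' i)
  subtree' i = record
    { nonempty = ne (IsTreeOn.nonempty (st i))
    ; connected = λ {a} {b} ha hb → conn a b ha hb
    ; acyclic = tree-acyclic-in S.tree }
    where
    open WalksIn i
    ne : (∃[ x ] x ∈ t i) → ∃[ a ] a ∈ t' i
    ne (x , hx) = image x , image-∈ hx
    conn : ∀ a b → a ∈ t' i → b ∈ t' i → WalkIn G (t' i) a b
    conn a b ha hb with reach-image a ha | reach-image b hb
    ... | x , hx , w1 | y , hy , w2 =
      w1 ++ʷ (map-walk (IsTreeOn.connected (st i) hx hy) ++ʷ reverseʷ w2)

  TwoNear : Fin (n T) → Set
  TwoNear x = ∃[ a ] ∃[ b ] (a ≢ b × (∀ i → x ∈ t i → a ∈ t' i × b ∈ t' i))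

  near-pair : ∀ {x} u v (eq : len u v ≡ M) q → q ≤ M
            → (∀ i → x ∈ t i → lo u v i ≤ q × suc q ≤ hi u v i) → TwoNear x
  near-pair u v eq q q≤M ends =
    pos u v eq q le , pos u v eq (suc q) (s≤s q≤M) , adjacent-distinct
    , λ i hx → pos-∈ u v i eq q le (proj₁ (ends i hx) , ℕₚ.≤-trans (ℕₚ.n≤1+n q) (proj₂ (ends i hx)))
             , pos-∈ u v i eq (suc q) (s≤s q≤M) (ℕₚ.≤-trans (proj₁ (ends i hx)) (ℕₚ.n≤1+n q) , proj₂ (ends i hx))
    where
    le : q ≤ suc M
    le = ℕₚ.≤-trans q≤M (ℕₚ.n≤1+n M)
    adjacent-distinct : pos u v eq q le ≢ pos u v eq (suc q) (s≤s q≤M)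
    adjacent-distinct same = irrefl G (subst (λ a → Adj G a (pos u v eq (suc q) (s≤s q≤M))) same
                                             (pos-adj u v eq q le (s≤s q≤M) q≤M))

  -- On the edge from x to its neighbour y: positions 0, 1 (x inner) or
  -- b₁, b₁ + 1 (x a leaf) when x < y; positions M, M + 1 or b₃, b₃ + 1 when y < x.
  two-near : ∀ x → TwoNear x
  two-near x with has-neighbour T TT two x
  ... | y , e with ℕₚ.<-cmp (toℕ x) (toℕ y)
  ...   | tri< x<y _ _ = dec-cases (inner? T TT x)
    (λ inner → near-pair x y (subdivided-edge x y e x<y) 0 z≤n
       (λ i hx → ℕₚ.≤-reflexive (lo-inner {x} {y} {i} hx inner) , ℕₚ.≤-trans (s≤s z≤n) (hi>b₁ {x} {y} {i} hx)))
    (λ leaf → near-pair x y (subdivided-edge x y e x<y) b₁ (ℕₚ.≤-trans b₁≤b₃ b₃≤M)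
       (λ i hx → lo≤b₁ {x} {y} {i} hx , hi>b₁ {x} {y} {i} hx))
  ...   | tri> _ _ y<x = dec-cases (inner? T TT x)
    (λ inner → near-pair y x (subdivided-edge y x (Graph.sym T e) y<x) M ℕₚ.≤-refl
       (λ i hx → ℕₚ.≤-trans (lo≤b₃ {y} {x} {i} hx) b₃≤M , ℕₚ.≤-reflexive (≡.sym (hi-inner {y} {x} {i} hx inner))))
    (λ leaf → near-pair y x (subdivided-edge y x (Graph.sym T e) y<x) b₃ b₃≤M
       (λ i hx → lo≤b₃ {y} {x} {i} hx , hi>b₃ {y} {x} {i} hx))
  ...   | tri≈ _ x≡y _ = ⊥-elim (irrefl T (subst (Adj T x) (≡.sym (Finₚ.toℕ-injective x≡y)) e))

  shared-vertex⇒meet : ∀ i j a → a ∈ t' i → a ∈ t' j → ∃[ x ] (x ∈ t i × x ∈ t j)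
  shared-vertex⇒meet i j a ha hb = go (label a) refl
    where
    go : ∀ l → label a ≡ l → ∃[ x ] (x ∈ t i × x ∈ t j)
    go (orig x) eq with ∈t'-label {i} a _ eq ha | ∈t'-label {j} a _ eq hb
    ... | (_ , hx) | (_ , hy) = x , hx , hy
    go (mid u v p) eq = shared-interval⇒meet u v i j (suc p) (∈t'-label {i} a _ eq ha) (∈t'-label {j} a _ eq hb)

  escape : ∀ i j x → x ∈ t i → ¬ (x ∈ t j) → ∃[ a ] (a ∈ t' i × ¬ (a ∈ t' j))
  escape i j x hi' hj = dec-cases (inner? T TT x)
    (λ nl → vertex (orig x) tt , ∈t'-of-label (vertex (orig x) tt) _ (label-orig x) (nl , hi')
          , λ m → hj (proj₂ (∈t'-label {j} (vertex (orig x) tt) _ (label-orig x) m)))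
    (λ nl → go nl (has-neighbour T TT two x))
    where
    go : ¬ Inner T x → ∃[ y ] Adj T x y → ∃[ a ] (a ∈ t' i × ¬ (a ∈ t' j))
    go nl (y , e) with ℕₚ.<-cmp (toℕ x) (toℕ y)
    ... | tri≈ _ c _ with Finₚ.toℕ-injective c
    ...   | refl = ⊥-elim (irrefl T e)
    go nl (y , e) | tri< lt _ _ =
      pos x y eqM b₁ leb₁
      , pos-∈ x y i eqM b₁ leb₁ (subst (_≤ b₁) (≡.sym (lo-leaf {x} {y} {i} hi' nl)) (A≤b₁ i)
                                 , ℕₚ.≤-trans (ℕₚ.n≤1+n b₁) (hi>b₁ {x} {y} {i} hi'))
      , λ m → ℕₚ.<-irrefl refl (ℕₚ.<-≤-trans (lo>b₁ {x} {y} {j} hj)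
                (proj₁ (∈t'-label {j} (pos x y eqM b₁ leb₁) _ (label-pos-mid x y eqM K leb₁ ltK) m)))
      where
      eqM : len x y ≡ M
      eqM = subdivided-edge x y e lt
      ltK' : suc K < M
      ltK' = ℕₚ.≤-<-trans b₁≤b₃ b₃<M
      ltK : K < M
      ltK = ℕₚ.<-trans (ℕₚ.n<1+n K) ltK'
      leb₁ : b₁ ≤ suc M
      leb₁ = ℕₚ.≤-trans (ℕₚ.<⇒≤ ltK') (ℕₚ.n≤1+n M)
    go nl (y , e) | tri> _ _ gt =
      pos y x eqM (suc b₃) (s≤s b₃≤M)
      , pos-∈ y x i eqM (suc b₃) (s≤s b₃≤M) (ℕₚ.≤-trans (lo≤b₃ {y} {x} {i} hi') (ℕₚ.n≤1+n b₃) , hi>b₃ {y} {x} {i} hi')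
      , λ m → ℕₚ.<-irrefl refl (ℕₚ.<-≤-trans (hi≤b₃ {y} {x} {j} hj)
                (proj₂ (∈t'-label {j} (pos y x eqM (suc b₃) (s≤s b₃≤M)) _ (label-pos-mid y x eqM b₃ (s≤s b₃≤M) b₃<M) m)))
      where
      eqM : len y x ≡ M
      eqM = subdivided-edge y x (Graph.sym T e) gt

  -- Inclusion with increasing keys is preserved; by κ-strict, inclusions
  -- of subtrees therefore stay nestings.
  t'-mono : ∀ i j → t i ⊆ t j → κ i ≤ κ j → t' i ⊆ t' j
  t'-mono i j s le {a} ha = ⇒∈t' (go (label a) (∈t'⇒ ha))
    where
    go : ∀ l → InLabel i l → InLabel j l
    go (orig x) (nl , hx) = nl , s hx
    go (mid u v p) h = In-mono u v i j (suc p) s le h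

  nesting-preserved : ∀ i j → t i ⊆ t j → (t' i ⊆ t' j) ⊎ (t' j ⊆ t' i)
  nesting-preserved i j s with κ i ≤? κ j
  ... | yes le = inj₁ (t'-mono i j s le)
  ... | no gt with _⊆?_ (t j) (t i)
  ...   | yes s' = inj₂ (t'-mono j i s' (ℕₚ.<⇒≤ (ℕₚ.≰⇒> gt)))
  ...   | no ns = ⊥-elim (gt (ℕₚ.<⇒≤ (κ-strict i j s ns)))

  meet⇒meet' : ∀ i j → Meet (t i) (t j) → Meet (t' i) (t' j)
  meet⇒meet' i j (x , m) with x∈p∩q⁻ (t i) (t j) m
  ... | hx , hy with two-near x
  ... | a , _ , _ , near = a , x∈p∩q⁺ (proj₁ (near i hx) , proj₁ (near j hy))

  meet'⇒meet : ∀ i j → Meet (t' i) (t' j) → Meet (t i) (t j)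
  meet'⇒meet i j (a , m) with x∈p∩q⁻ (t' i) (t' j) m
  ... | ha , hb with shared-vertex⇒meet i j a ha hb
  ... | x , hx , hy = x , x∈p∩q⁺ (hx , hy)

  ⊈-preserved : ∀ i j → ¬ (t i ⊆ t j) → ¬ (t' i ⊆ t' j)
  ⊈-preserved i j ti⊈tj t'i⊆t'j with ⊈⇒∃∉ (t i) (t j) ti⊈tj
  ... | y , yi , yj with escape i j y yi yj
  ... | c , ci , cj = cj (t'i⊆t'j ci)

  similar : ∀ i j → Similar (t i) (t j) (t' i) (t' j)
  similar i j = similar-by (meet⇒meet' i j) (meet'⇒meet i j) (⊈-preserved i j) (⊈-preserved j i)
                           (nesting-preserved i j) (nesting-preserved j i)

  FirstStep : Fin (n T) → Fin (n T) → Set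
  FirstStep x y = Σ (Fin (n G)) λ b →
    ((label b ≡ mid x y 0) ⊎ (label b ≡ mid y x (pred M)))
    × (∀ a → label a ≡ orig x → Adj G a b)
    × (∀ i → Inner T x → x ∈ t i → b ∈ t' i)

  first-step : ∀ x y → Adj T x y → FirstStep x y
  first-step x y e with ℕₚ.<-cmp (toℕ x) (toℕ y)
  ... | tri≈ _ c _ with Finₚ.toℕ-injective c
  ...   | refl = ⊥-elim (irrefl T e)
  first-step x y e | tri< lt _ _ =
    b , inj₁ db
    , (λ a da → proj₂ (S.adj a b) (subst₂ (LAdj len) (≡.sym da) (≡.sym db) (inj₁ (refl , refl))))
    , λ i nl hx → pos-∈ x y i eqM 1 (s≤s z≤n) (subst (_≤ 1) (≡.sym (lo-inner {x} {y} {i} hx nl)) z≤n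
                                               , ℕₚ.≤-trans (s≤s z≤n) (hi>b₁ {x} {y} {i} hx))
    where
    eqM : len x y ≡ M
    eqM = subdivided-edge x y e lt
    b : Fin (n G)
    b = pos x y eqM 1 (s≤s z≤n)
    db : label b ≡ mid x y 0
    db = label-pos-mid x y eqM 0 (s≤s z≤n) (ℕₚ.≤-<-trans z≤n b₃<M)
  first-step x y e | tri> _ _ gt =
    b , inj₂ db
    , (λ a da → proj₂ (S.adj a b) (subst₂ (LAdj len) (≡.sym da) (≡.sym db) (inj₂ (refl , ≡.sym eqM))))
    , λ i nl hx → pos-∈ y x i eqM M (ℕₚ.n≤1+n M) (ℕₚ.≤-trans (lo≤b₃ {y} {x} {i} hx) b₃≤M
                                    , ℕₚ.≤-trans (ℕₚ.n≤1+n M) (ℕₚ.≤-reflexive (≡.sym (hi-inner {y} {x} {i} hx nl))))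
    where
    eqM : len y x ≡ M
    eqM = subdivided-edge y x (Graph.sym T e) gt
    b : Fin (n G)
    b = pos y x eqM M (ℕₚ.n≤1+n M)
    db : label b ≡ mid y x (pred M)
    db = label-pos-mid y x eqM (pred M) (ℕₚ.n≤1+n M) ℕₚ.≤-refl

  -- An inner vertex x of T has two neighbours in t' i, one on each of two
  -- edges at x, so it is never a leaf of t' i.
  orig-not-leaf : ∀ i a x → label a ≡ orig x → ¬ IsLeafOf G a (t' i)
  orig-not-leaf i a x da (ha , w , hw , aw , uniq) with ∈t'-label {i} a _ da ha
  ... | (y1 , y2 , ne , e1 , e2) , hx with first-step x y1 e1 | first-step x y2 e2
  ... | b1 , l1 , adj1 , m1 | b2 , l2 , adj2 , m2 =
    dist l1 l2 (trans (uniq b1 (m1 i nl hx) (adj1 a da)) (≡.sym (uniq b2 (m2 i nl hx) (adj2 a da))))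
    where
    nl : Inner T x
    nl = y1 , y2 , ne , e1 , e2
    dist : ((label b1 ≡ mid x y1 0) ⊎ (label b1 ≡ mid y1 x (pred M)))
         → ((label b2 ≡ mid x y2 0) ⊎ (label b2 ≡ mid y2 x (pred M))) → b1 ≢ b2
    dist (inj₁ d1) (inj₁ d2) eq = ne (proj₁ (proj₂ (mid-injective (trans (≡.sym d1) (trans (cong label eq) d2)))))
    dist (inj₁ d1) (inj₂ d2) eq with mid-injective (trans (≡.sym d1) (trans (cong label eq) d2))
    ... | refl , _ , _ = irrefl T e2
    dist (inj₂ d1) (inj₁ d2) eq with mid-injective (trans (≡.sym d1) (trans (cong label eq) d2))
    ... | refl , _ , _ = irrefl T e1
    dist (inj₂ d1) (inj₂ d2) eq = ne (proj₁ (mid-injective (trans (≡.sym d1) (trans (cong label eq) d2))))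

  mid-neighbours : ∀ u v p l → len u v ≡ M → Valid len l → LAdj len (mid u v p) l
         → (l ≡ along u v p) ⊎ (l ≡ along u v (suc (suc p)))
  mid-neighbours u v .0 (orig .u) eqM _ (inj₁ (refl , refl)) = inj₁ refl
  mid-neighbours u v p (orig .v) eqM _ (inj₂ (refl , sp)) =
    inj₂ (≡.sym (trans (cong (λ q → along u v (suc q)) (trans sp eqM)) (along-end u v)))
  mid-neighbours u v p (mid .u .v .(suc p)) eqM w (refl , refl , inj₁ refl) =
    inj₂ (≡.sym (along-mid u v (suc p) (subst (suc p <_) eqM w)))
  mid-neighbours u v .(suc p') (mid .u .v p') eqM w (refl , refl , inj₂ refl) =
    inj₁ (≡.sym (along-mid u v p' (subst (p' <_) eqM w)))

  along-cases : ∀ u v q → (along u v (suc q) ≡ mid u v q) ⊎ (along u v (suc q) ≡ orig v)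
  along-cases u v q with q <? M
  ... | yes _ = inj₁ refl
  ... | no _ = inj₂ refl

  along-distinct : ∀ u v p → u ≢ v → p < M → along u v p ≢ along u v (suc (suc p))
  along-distinct u v zero ne lt eq with along-cases u v 1
  ... | inj₁ d = orig≢mid (trans eq d)
  ... | inj₂ d = ne (orig-injective (trans eq d))
  along-distinct u v (suc p) ne lt eq with along-cases u v (suc (suc p))
  ... | inj₁ d = ℕₚ.<-irrefl (proj₂ (proj₂ (mid-injective (trans (≡.sym (along-mid u v p (ℕₚ.<-trans (ℕₚ.n<1+n p) lt))) (trans eq d)))))
                   (ℕₚ.<-trans (ℕₚ.n<1+n p) (ℕₚ.n<1+n (suc p)))
  ... | inj₂ d = orig≢mid (≡.sym (trans (≡.sym (along-mid u v p (ℕₚ.<-trans (ℕₚ.n<1+n p) lt))) (trans eq d)))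

  leaf-at-endpoint : ∀ i a u v p → label a ≡ mid u v p → IsLeafOf G a (t' i) → (lo u v i ≡ suc p) ⊎ (hi u v i ≡ suc p)
  leaf-at-endpoint i a u v p da (ha , w , hw , aw , uniq) with mid-valid⇒edge (subst (Valid len) da (valid a))
  ... | eqM , e , lt = result (In? u v i p) (In? u v i (suc (suc p)))
    where
    open WalksIn i
    pM : p < M
    pM = subst (p <_) eqM (subst (Valid len) da (valid a))
    lp : p ≤ suc M
    lp = ℕₚ.≤-trans (ℕₚ.<⇒≤ pM) (ℕₚ.n≤1+n M)
    lsp : suc p ≤ suc M
    lsp = ℕₚ.≤-trans pM (ℕₚ.n≤1+n M)
    lssp : suc (suc p) ≤ suc M
    lssp = s≤s pM
    aEq : a ≡ pos u v eqM (suc p) lsp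
    aEq = ≡.sym (S.vertex-unique a _ (trans da (≡.sym (along-mid u v p pM))) _)
    ih : In u v i (suc p)
    ih = ∈t'-label {i} a _ da ha
    n- n+ : Fin (n G)
    n- = pos u v eqM p lp
    n+ = pos u v eqM (suc (suc p)) lssp
    adj- : Adj G a n-
    adj- = subst (λ z → Adj G z n-) (≡.sym aEq) (Graph.sym G (pos-adj u v eqM p lp lsp (ℕₚ.<⇒≤ pM)))
    adj+ : Adj G a n+
    adj+ = subst (λ z → Adj G z n+) (≡.sym aEq) (pos-adj u v eqM (suc p) lsp lssp pM)
    u≢v : u ≢ v
    u≢v refl = ℕₚ.<-irrefl refl lt
    result : Dec (In u v i p) → Dec (In u v i (suc (suc p))) → (lo u v i ≡ suc p) ⊎ (hi u v i ≡ suc p)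
    result (yes i1) (yes i2) = ⊥-elim (along-distinct u v p u≢v pM
      (trans (≡.sym (label-pos u v eqM p lp)) (trans (cong label (trans (uniq n- (pos-∈ u v i eqM p lp i1) adj-)
        (≡.sym (uniq n+ (pos-∈ u v i eqM _ lssp i2) adj+)))) (label-pos u v eqM _ lssp))))
    result (no i1) (no i2) with mid-neighbours u v p (label w) eqM (valid w)
                                  (subst (λ l → LAdj len l (label w)) da (proj₁ (S.adj a w) aw))
    ... | inj₁ d = ⊥-elim (i1 (along-∈⁻ u v i p lp (∈t'-label {i} w _ d hw)))
    ... | inj₂ d = ⊥-elim (i2 (along-∈⁻ u v i (suc (suc p)) lssp (∈t'-label {i} w _ d hw)))
    result (yes i1) (no i2) = inj₂ (ℕₚ.≤-antisym (ℕₚ.≮⇒≥ (λ lt' → i2 (ℕₚ.≤-trans (proj₁ ih) (ℕₚ.n≤1+n _) , lt'))) (proj₂ ih))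
    result (no i1) (yes i2) = inj₁ (ℕₚ.≤-antisym (proj₁ ih) (ℕₚ.≮⇒≥ λ lt' → i1 (s≤s⁻¹ lt' , ℕₚ.≤-trans (ℕₚ.n≤1+n p) (proj₂ ih))))

  -- Distinct subtrees have no common leaf: leaves at original vertices do
  -- not exist, and leaves at new vertices are special positions of i.
  no-shared-leaf : ∀ i j → i ≢ j → ∀ a → ¬ (IsLeafOf G a (t' i) × IsLeafOf G a (t' j))
  no-shared-leaf i j ne a (Li , Lj) = go (label a) refl
    where
    go : ∀ l → label a ≡ l → ⊥
    go (orig x) da = orig-not-leaf i a x da Li
    go (mid u v p) da with mid-valid⇒edge (subst (Valid len) da (valid a))
    ... | eqM , _ , _ = fin (ev i (leaf-at-endpoint i a u v p da Li)) (ev j (leaf-at-endpoint j a u v p da Lj))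
      where
      pM : suc p ≤ M
      pM = subst (p <_) eqM (subst (Valid len) da (valid a))
      ev : ∀ i' → (lo u v i' ≡ suc p) ⊎ (hi u v i' ≡ suc p) → IsSpecial i' (suc p)
      ev i' (inj₁ x) = lo-special {u} {v} {i'} (s≤s z≤n) pM x
      ev i' (inj₂ x) = hi-special {u} {v} {i'} (s≤s z≤n) pM x
      fin : IsSpecial i (suc p) → IsSpecial j (suc p) → ⊥
      fin (r , e1) (r' , e2) = ne (special-determines r r' i j (trans e1 (≡.sym e2)))

  nidlp : NIDLP G t'
  nidlp = two-vertices , meet-twice , no-shared-leaf
    where
    two-vertices : ∀ i → HasTwoVertices (t' i)
    two-vertices i with IsTreeOn.nonempty (st i)
    ... | x , hx with two-near x
    ... | a , b , ne , f = a , b , ne , f i hx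
    meet-twice : ∀ i j → Disjoint (t' i) (t' j) ⊎ HasTwoVertices (t' i ∩ t' j)
    meet-twice i j with Finₚ.any? (λ x → x ∈? (t i ∩ t j))
    ... | yes (x , m) with x∈p∩q⁻ (t i) (t j) m
    ... | hx , hy with two-near x
    ... | a , b , ne , f = inj₂ (a , b , ne , x∈p∩q⁺ (proj₁ (f i hx) , proj₁ (f j hy))
                                          , x∈p∩q⁺ (proj₂ (f i hx) , proj₂ (f j hy)))
    meet-twice i j | no nm = inj₁ (λ m' → nm (meet'⇒meet i j m'))


lemma2 : (T : Graph) → IsTree T → 2 ≤ n T →
         (k : ℕ) (t : Fin k → Subset (n T)) → (∀ i → IsSubtree T (t i)) →
         Σ Graph λ T' → IsTree T' × Σ (Fin k → Subset (n T')) λ t' →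
           (∀ i → IsSubtree T' (t' i)) ×
           (∀ i j → Similar (t i) (t j) (t' i) (t' j)) ×
           IsSubdivisionOf T' T ×
           NIDLP T' t'
lemma2 T TT two k t st =
  S.G , S.tree , t' , subtree' , similar , (S.G , S.iter , iso-refl S.G) , nidlp
  where
  open Construction T TT two k t st
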